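{- Let $N_f$ be an even positive integer and put $\tilde N_f = N_f+1$. Consider a sequence of networks $G_1, G_2, \dots$ with node counts $N_k = N_{k-1}+1$ for $k \ge 2$, where $N_f < N_k - 2$ for all $k$. Together with the networks, maintain an auxiliary cycle $C_k$ whose node set is the node set of $G_k$ ($C_k$ is bookkeeping only). Let $G_1$ be the network on the nodes of $C_1$ in which every node is linked to every node within distance $N_f/2$ along $C_1$, and in addition: if $N_1$ is even, every pair of nodes at distance $N_1/2$ along $C_1$ is linked; if $N_1$ is odd, every node is linked to at least one node at distance $(N_1-1)/2$ along $C_1$, in such a way that exactly one node is adjacent to $\tilde N_f+1$ nodes. For $k \ge 2$, obtain $G_k$ from $G_{k-1}$ as follows: (i) form $C_k$ from $C_{k-1}$ by inserting the new node between two adjacent nodes of $C_{k-1}$; (ii) link the new node to all nodes within distance $N_f/2$ of it along $C_k$; (iii) if $N_k$ is even, link the new node to the node at distance $N_k/2$ along $C_k$; if $N_k$ is odd, link the new node to a node at distance $(N_k-1)/2$ along $C_k$; (iv) if $N_k$ is even, link every pair of nodes at distance $N_k/2$ along $C_k$ that is not already linked; no links are removed. Then $G_i$ is a subnetwork of $G_j$ for all $i \le j$, every $G_k$ is $N_f$-robust, and the number of links $L_k$ of $G_k$ satisfies $L_k \le N_k(N_f+1) + N_k^2/8$.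
   Context: A network is a finite simple undirected graph; links are edges. For an integer $N_f$, a network $G$ is $N_f$-robust if for every set $S$ of $N_f$ nodes of $G$, the network obtained by deleting the nodes of $S$ and their incident links is connected. The distance along a cycle between two of its nodes is the number of edges of the shorter of the two paths in the cycle between them. -}

module Defs where

open import Data.Nat using (ℕ; zero; suc; _+_; _*_; _∸_; _≤_; _<_; _<ᵇ_; _⊓_; ∣_-_∣; _/_; _%_)
open import Data.Nat.Properties using (+-monoˡ-≤)
open import Data.Bool using (Bool; true; false; if_then_else_; _∧_)
open import Data.Fin using (Fin; toℕ; fromℕ; inject₁; inject≤)
open import Data.Fin.Subset using (Subset; _∉_; ∣_∣)
open import Data.List using (List; map; allFin)
open import Data.Nat.ListAction using (sum)
open import Data.Product using (Σ; _×_; _,_)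
open import Data.Sum using (_⊎_)
open import Function.Definitions using (Injective)
open import Function.Bundles using (_⇔_)
open import Relation.Binary.PropositionalEquality using (_≡_; _≢_)

record Graph (n : ℕ) : Set where
  field
    adj        : Fin n → Fin n → Bool
    adj-sym    : ∀ u v → adj u v ≡ adj v u
    adj-irrefl : ∀ u → adj u u ≡ false

open Graph public

Linked : ∀ {n} → Graph n → Fin n → Fin n → Set
Linked G u v = adj G u v ≡ true

degree : ∀ {n} → Graph n → Fin n → ℕ
degree {n} G u = sum (map (λ v → if adj G u v then 1 else 0) (allFin n))

numLinks : ∀ {n} → Graph n → ℕ
numLinks {n} G =
  sum (map (λ u → sum (map (λ v → if (toℕ u <ᵇ toℕ v) ∧ adj G u v then 1 else 0)
                           (allFin n)))
           (allFin n))

-- Paths in G avoiding the deleted set S (the start node is assumed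
-- outside S by the caller; every later node is required to be outside S).
data PathAvoiding {n} (G : Graph n) (S : Subset n) : Fin n → Fin n → Set where
  here : ∀ {u} → PathAvoiding G S u u
  step : ∀ {u v w} → Linked G u v → v ∉ S → PathAvoiding G S v w →
         PathAvoiding G S u w

ConnectedWithout : ∀ {n} → Graph n → Subset n → Set
ConnectedWithout {n} G S = ∀ (u v : Fin n) → u ∉ S → v ∉ S → PathAvoiding G S u v

Robust : ℕ → ∀ {n} → Graph n → Set
Robust f {n} G = ∀ (S : Subset n) → ∣ S ∣ ≡ f → ConnectedWithout G S

Subnetwork : ∀ {m n} → .(m ≤ n) → Graph m → Graph n → Set
Subnetwork {m} le G H =
  ∀ (u v : Fin m) → Linked G u v → Linked H (inject≤ u le) (inject≤ v le)

-- Cycles on the node set Fin n, given by the position of each node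
-- (a bijection Fin n → Fin n); node at position i is adjacent on the
-- cycle to the nodes at positions i ± 1 (mod n).

CyclePos : ℕ → Set
CyclePos n = Fin n → Fin n

cycDist : ∀ {n} → CyclePos n → Fin n → Fin n → ℕ
cycDist {n} pos u v = d ⊓ (n ∸ d)
  where d = ∣ toℕ (pos u) - toℕ (pos v) ∣

shiftAt : ℕ → ℕ → ℕ
shiftAt p i = if i <ᵇ p then i else suc i

-- pos' (on Fin (suc n)) is obtained from pos (on Fin n) by inserting
-- the new node fromℕ n between two adjacent nodes of the old cycle
-- (position p; p = 0 and p = n both mean "between the last and first").
Inserted : ∀ {n} → CyclePos n → CyclePos (suc n) → Set
Inserted {n} pos pos' =
  Σ ℕ λ p → p ≤ n × toℕ (pos' (fromℕ n)) ≡ p ×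
    (∀ (u : Fin n) → toℕ (pos' (inject₁ u)) ≡ shiftAt p (toℕ (pos u)))

InitialNet : (Nf : ℕ) → ∀ {n} → CyclePos n → Graph n → Set
InitialNet Nf {n} pos G =
  (n % 2 ≡ 0 →
    ∀ u v → Linked G u v ⇔ ((u ≢ v × cycDist pos u v ≤ Nf / 2) ⊎ cycDist pos u v ≡ n / 2)) ×
  (n % 2 ≡ 1 →
    (∀ u v → u ≢ v → cycDist pos u v ≤ Nf / 2 → Linked G u v) ×
    (∀ u v → Linked G u v → (u ≢ v × cycDist pos u v ≤ Nf / 2) ⊎ cycDist pos u v ≡ (n ∸ 1) / 2) ×
    (∀ u → Σ (Fin n) λ v → cycDist pos u v ≡ (n ∸ 1) / 2 × Linked G u v) ×
    (Σ (Fin n) λ u → degree G u ≡ (Nf + 1) + 1 ×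
       (∀ w → degree G w ≡ (Nf + 1) + 1 → w ≡ u)))

GrowthStep : (Nf : ℕ) → ∀ {n} → CyclePos n → Graph n →
             CyclePos (suc n) → Graph (suc n) → Set
GrowthStep Nf {n} pos G pos' G' =
  Inserted pos pos' ×
  (suc n % 2 ≡ 0 →
    (∀ u v → Linked G' (inject₁ u) (inject₁ v) ⇔
               (Linked G u v ⊎ cycDist pos' (inject₁ u) (inject₁ v) ≡ suc n / 2)) ×
    (∀ v → Linked G' w v ⇔
               ((v ≢ w × cycDist pos' w v ≤ Nf / 2) ⊎ cycDist pos' w v ≡ suc n / 2))) ×
  (suc n % 2 ≡ 1 →
    (∀ u v → Linked G' (inject₁ u) (inject₁ v) ⇔ Linked G u v) ×
    (Σ (Fin (suc n)) λ t → cycDist pos' w t ≡ (suc n ∸ 1) / 2 ×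
      (∀ v → Linked G' w v ⇔ ((v ≢ w × cycDist pos' w v ≤ Nf / 2) ⊎ v ≡ t))))
  where
  w : Fin (suc n)
  w = fromℕ n

-- embedding index bound used for G_i ⊆ G_j (0-indexed: G k has k + N₁ nodes)
idx≤ : ∀ {i j} N₁ → i ≤ j → i + N₁ ≤ j + N₁
idx≤ N₁ le = +-monoˡ-≤ N₁ le

-- Read every network through the positions of its nodes on the auxiliary cycle. With
-- h = N_f/2, each G_k contains all links of cycle length at most h, and every node has a
-- link to a node at cycle distance ⌊N_k/2⌋; both properties survive a growth step, because
-- inserting a node stretches old cycle distances by at most one, and when N_k is odd the
-- old antipodal pairs of the even cycle C_{k-1} stay at distance ⌊N_k/2⌋.
--
-- Robustness: delete 2h nodes and walk from u to v along the cycle in jumps of length ≤ h,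
-- and likewise from v back to u. A walk only gets stuck in front of h consecutive deleted
-- nodes, so if both get stuck the deleted nodes are exactly two such gaps and the alive
-- nodes form two arcs, each connected by short links. The link from the first node of the
-- shorter arc to cycle distance ⌊N_k/2⌋ lands in the longer arc.
--
-- Links: initially every node has at most 2h + 2 neighbours; a step to odd N_k adds at most
-- 2h + 1 links and a step to even N_k at most 2h + N_k/2. Two steps together add about
-- 4h + N_k/2, which sums to N_k (N_f + 1) + N_k²/8.

module Submission where

open import Defs
open import Data.Nat.Properties
open import Algebra.Properties.CommutativeMonoid.Sum +-0-commutativeMonoid
  using (sum; sum-syntax; sum-cong-≗; ∑-distrib-+; ∑-comm; sum-init-last; sum-permute)
open import Data.Bool using (Bool; true; false; if_then_else_; _∧_; T)
open import Data.Bool.Properties using (T-≡)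
open import Data.Empty using (⊥; ⊥-elim)
open import Data.Fin using (Fin; zero; suc; toℕ; fromℕ; fromℕ<; inject₁; punchOut)
open import Data.Fin.Permutation using (permutation)
open import Data.Fin.Properties
  using (toℕ-injective; toℕ<n; toℕ-fromℕ<; toℕ-inject₁; toℕ-fromℕ; toℕ-inject≤;
         any?; punchOut-injective; injective⇒≤; fromℕ≢inject₁)
  renaming (_≟_ to _≟ᶠ_; suc-injective to fsuc-injective)
open import Data.Fin.Subset using (Subset; _∉_; ∣_∣)
open import Data.Fin.Subset.Properties using (_∈?_)
open import Data.List using (map; allFin; tabulate)
open import Data.List.Properties using (map-tabulate; map-cong)
open import Data.Nat
  using (ℕ; zero; suc; _+_; _*_; _∸_; _≤_; _<_; _≤?_; _<?_; _≟_; _≡ᵇ_; _<ᵇ_;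
         z≤n; s≤s; _⊓_; ∣_-_∣; _/_; _%_; NonZero; >-nonZero; _≤′_; ≤′-refl; ≤′-step)
open import Data.Nat.DivMod
open import Data.Nat.ListAction using () renaming (sum to sumᴸ)
open import Data.Nat.Tactic.RingSolver using (solve-∀)
open import Data.Product using (∃; _×_; _,_; proj₁; proj₂)
open import Data.Sum as Sum using (_⊎_; inj₁; inj₂; [_,_]′)
open import Data.Vec using (lookup; []; _∷_)
open import Data.Vec.Properties using ([]=⇒lookup)
open import Function using (_∘_)
open import Function.Bundles using (Equivalence)
open import Function.Definitions using (Injective)
open import Relation.Binary.Definitions using (tri<; tri≈; tri>)
open import Relation.Binary.PropositionalEquality
open import Relation.Nullary using (yes; no; ¬_; Dec)
open import Relation.Nullary.Decidable using (¬?)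

open Equivalence using (to; from)

<ᵇ-true : ∀ {m n} → m < n → (m <ᵇ n) ≡ true
<ᵇ-true m<n = to T-≡ (<⇒<ᵇ m<n)

<ᵇ-sound : ∀ m n → (m <ᵇ n) ≡ true → m < n
<ᵇ-sound m n eq = <ᵇ⇒< m n (from T-≡ eq)

<ᵇ-false : ∀ {m n} → n ≤ m → (m <ᵇ n) ≡ false
<ᵇ-false {m} {n} n≤m with m <ᵇ n in eq
... | false = refl
... | true  = ⊥-elim (≤⇒≯ n≤m (<ᵇ-sound m n eq))

<ᵇ-false⇒≥ : ∀ m n → (m <ᵇ n) ≡ false → n ≤ m
<ᵇ-false⇒≥ m n eq = ≮⇒≥ (λ m<n → subst T eq (<⇒<ᵇ m<n))

≡ᵇ-true : ∀ {m n} → m ≡ n → (m ≡ᵇ n) ≡ true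
≡ᵇ-true {m} {n} eq = to T-≡ (≡⇒≡ᵇ m n eq)

≡ᵇ-sound : ∀ {m n} → (m ≡ᵇ n) ≡ true → m ≡ n
≡ᵇ-sound {m} {n} eq = ≡ᵇ⇒≡ m n (from T-≡ eq)

𝟙 : Bool → ℕ
𝟙 b = if b then 1 else 0

𝟙-≤ : ∀ {b x} → (b ≡ true → 1 ≤ x) → 𝟙 b ≤ x
𝟙-≤ {false} _ = z≤n
𝟙-≤ {true}  f = f refl

𝟙-true : ∀ {b} → b ≡ true → 1 ≤ 𝟙 b
𝟙-true refl = ≤-refl

𝟙-≤-𝟙 : ∀ {a b} → (a ≡ true → b ≡ true) → 𝟙 a ≤ 𝟙 b
𝟙-≤-𝟙 f = 𝟙-≤ (𝟙-true ∘ f)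

𝟙-≤-+ : ∀ {b x y} → (b ≡ true → 1 ≤ x ⊎ 1 ≤ y) → 𝟙 b ≤ x + y
𝟙-≤-+ {x = x} {y} f = 𝟙-≤ λ eq → [ (λ p → ≤-trans p (m≤m+n x y)) , (λ p → ≤-trans p (m≤n+m y x)) ]′ (f eq)

∑-mono-≤ : ∀ {n} {f g : Fin n → ℕ} → (∀ i → f i ≤ g i) → sum f ≤ sum g
∑-mono-≤ {zero}  _   = z≤n
∑-mono-≤ {suc n} f≤g = +-mono-≤ (f≤g zero) (∑-mono-≤ (f≤g ∘ suc))

∑-const : ∀ n c → ∑[ i < n ] c ≡ n * c
∑-const zero    c = refl
∑-const (suc n) c = cong (c +_) (∑-const n c)

∑-init-≤ : ∀ {n} (f : Fin (suc n) → ℕ) → ∑[ i < n ] f (inject₁ i) ≤ sum f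
∑-init-≤ f = ≤-trans (m≤m+n _ _) (≤-reflexive (sym (sum-init-last f)))

∑-𝟙-unique-≤1 : ∀ {n} (b : Fin n → Bool) → (∀ i j → b i ≡ true → b j ≡ true → i ≡ j) →
  ∑[ i < n ] 𝟙 (b i) ≤ 1
∑-𝟙-unique-≤1 {zero}  b unique = z≤n
∑-𝟙-unique-≤1 {suc n} b unique with b zero in eq
... | false = ∑-𝟙-unique-≤1 (b ∘ suc) λ i j p q → fsuc-injective (unique (suc i) (suc j) p q)
... | true  = ≤-reflexive (cong suc (trans (sum-cong-≗ rest-false) (trans (∑-const n 0) (*-zeroʳ n))))
  where
  rest-false : ∀ i → 𝟙 (b (suc i)) ≡ 0
  rest-false i with b (suc i) in eq′
  ... | false = refl
  ... | true with () ← unique zero (suc i) eq eq′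

sumᴸ-allFin : ∀ n (f : Fin n → ℕ) → sumᴸ (map f (allFin n)) ≡ sum f
sumᴸ-allFin n f = trans (cong sumᴸ (map-tabulate (λ i → i) f)) (sumᴸ-tabulate n f)
  where
  sumᴸ-tabulate : ∀ n (f : Fin n → ℕ) → sumᴸ (tabulate f) ≡ sum f
  sumᴸ-tabulate zero    f = refl
  sumᴸ-tabulate (suc n) f = cong (f zero +_) (sumᴸ-tabulate n (f ∘ suc))

countPairs : ∀ n → (Fin n → Fin n → Bool) → ℕ
countPairs n f = ∑[ u < n ] ∑[ v < n ] 𝟙 ((toℕ u <ᵇ toℕ v) ∧ f u v)

numLinks≡countPairs : ∀ {n} (G : Graph n) → numLinks G ≡ countPairs n (adj G)
numLinks≡countPairs {n} G =
  trans (cong sumᴸ (map-cong (λ u → sumᴸ-allFin n _) (allFin n))) (sumᴸ-allFin n _)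

countPairs-last : ∀ n f →
  countPairs (suc n) f ≡
    countPairs n (λ u v → f (inject₁ u) (inject₁ v)) + ∑[ u < n ] 𝟙 (f (inject₁ u) (fromℕ n))
countPairs-last n f = begin
  countPairs (suc n) f
    ≡⟨ sum-init-last (λ u → sum (F u)) ⟩
  ∑[ u < n ] sum (F (inject₁ u)) + sum (F (fromℕ n))
    ≡⟨ cong₂ _+_ (sum-cong-≗ (λ u → sum-init-last (F (inject₁ u))))
                 (trans (sum-cong-≗ last-row-empty) (trans (∑-const (suc n) 0) (*-zeroʳ n))) ⟩
  ∑[ u < n ] (∑[ v < n ] F (inject₁ u) (inject₁ v) + F (inject₁ u) (fromℕ n)) + 0
    ≡⟨ trans (+-identityʳ _) (∑-distrib-+ {n} _ _) ⟩
  ∑[ u < n ] ∑[ v < n ] F (inject₁ u) (inject₁ v) + ∑[ u < n ] F (inject₁ u) (fromℕ n)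
    ≡⟨ cong₂ _+_ (sum-cong-≗ λ u → sum-cong-≗ λ v →
                   cong (λ b → 𝟙 (b ∧ f (inject₁ u) (inject₁ v))) (cong₂ _<ᵇ_ (toℕ-inject₁ u) (toℕ-inject₁ v)))
                 (sum-cong-≗ λ u → cong (λ b → 𝟙 (b ∧ f (inject₁ u) (fromℕ n))) (<ᵇ-true (inject₁<fromℕ u))) ⟩
  countPairs n (λ u v → f (inject₁ u) (inject₁ v)) + ∑[ u < n ] 𝟙 (f (inject₁ u) (fromℕ n)) ∎
  where
  open ≡-Reasoning
  F : Fin (suc n) → Fin (suc n) → ℕ
  F u v = 𝟙 ((toℕ u <ᵇ toℕ v) ∧ f u v)
  inject₁<fromℕ : ∀ u → toℕ (inject₁ u) < toℕ (fromℕ n)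
  inject₁<fromℕ u = subst₂ _<_ (sym (toℕ-inject₁ u)) (sym (toℕ-fromℕ n)) (toℕ<n u)
  last-row-empty : ∀ v → F (fromℕ n) v ≡ 0
  last-row-empty v rewrite <ᵇ-false {toℕ (fromℕ n)} {toℕ v}
                             (subst (toℕ v ≤_) (sym (toℕ-fromℕ n)) (≤-pred (toℕ<n v))) = refl

countPairs-handshake : ∀ n (f : Fin n → Fin n → Bool) →
  (∀ u v → f u v ≡ f v u) → (∀ u → f u u ≡ false) →
  countPairs n f + countPairs n f ≡ ∑[ u < n ] ∑[ v < n ] 𝟙 (f u v)
countPairs-handshake n f sym-f irrefl-f = sym (begin
  ∑[ u < n ] ∑[ v < n ] 𝟙 (f u v)
    ≡⟨ sum-cong-≗ (λ u → trans (sum-cong-≗ (split u)) (∑-distrib-+ {n} _ _)) ⟩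
  ∑[ u < n ] (∑[ v < n ] 𝟙 ((toℕ u <ᵇ toℕ v) ∧ f u v) + ∑[ v < n ] 𝟙 ((toℕ v <ᵇ toℕ u) ∧ f v u))
    ≡⟨ ∑-distrib-+ {n} _ _ ⟩
  countPairs n f + ∑[ u < n ] ∑[ v < n ] 𝟙 ((toℕ v <ᵇ toℕ u) ∧ f v u)
    ≡⟨ cong (countPairs n f +_) (∑-comm (λ u v → 𝟙 ((toℕ v <ᵇ toℕ u) ∧ f v u))) ⟩
  countPairs n f + countPairs n f ∎)
  where
  open ≡-Reasoning
  split : ∀ u v → 𝟙 (f u v) ≡ 𝟙 ((toℕ u <ᵇ toℕ v) ∧ f u v) + 𝟙 ((toℕ v <ᵇ toℕ u) ∧ f v u)
  split u v with <-cmp (toℕ u) (toℕ v)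
  ... | tri< u<v _ _ rewrite <ᵇ-true u<v | <ᵇ-false (<⇒≤ u<v) = sym (+-identityʳ _)
  ... | tri> _ _ v<u rewrite <ᵇ-true v<u | <ᵇ-false (<⇒≤ v<u) | sym-f u v = refl
  ... | tri≈ _ u≡v _ rewrite toℕ-injective u≡v | irrefl-f v | <ᵇ-false (≤-refl {toℕ v}) = refl

𝟙-∧-≤-+ : ∀ l {c a b} → (c ≡ true → a ≡ true ⊎ b ≡ true) → 𝟙 (l ∧ c) ≤ 𝟙 (l ∧ a) + 𝟙 (l ∧ b)
𝟙-∧-≤-+ false _ = z≤n
𝟙-∧-≤-+ true  f = 𝟙-≤-+ (Sum.map 𝟙-true 𝟙-true ∘ f)

𝟙-∧-≤ : ∀ l {c a} → (c ≡ true → a ≡ true) → 𝟙 (l ∧ c) ≤ 𝟙 (l ∧ a)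
𝟙-∧-≤ false _ = z≤n
𝟙-∧-≤ true  f = 𝟙-≤-𝟙 f

countPairs-mono : ∀ n {f g : Fin n → Fin n → Bool} →
  (∀ u v → f u v ≡ true → g u v ≡ true) → countPairs n f ≤ countPairs n g
countPairs-mono n f⇒g = ∑-mono-≤ {n} λ u → ∑-mono-≤ {n} λ v → 𝟙-∧-≤ (toℕ u <ᵇ toℕ v) (f⇒g u v)

countPairs-∪ : ∀ n {f g k : Fin n → Fin n → Bool} →
  (∀ u v → f u v ≡ true → g u v ≡ true ⊎ k u v ≡ true) → countPairs n f ≤ countPairs n g + countPairs n k
countPairs-∪ n {f} {g} {k} f⇒g∪k = begin
  countPairs n f
    ≤⟨ ∑-mono-≤ {n} (λ u → ∑-mono-≤ {n} λ v → 𝟙-∧-≤-+ (toℕ u <ᵇ toℕ v) (f⇒g∪k u v)) ⟩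
  ∑[ u < n ] ∑[ v < n ] (𝟙 ((toℕ u <ᵇ toℕ v) ∧ g u v) + 𝟙 ((toℕ u <ᵇ toℕ v) ∧ k u v))
    ≡⟨ trans (sum-cong-≗ {n} (λ u → ∑-distrib-+ {n} _ _)) (∑-distrib-+ {n} _ _) ⟩
  countPairs n g + countPairs n k ∎
  where open ≤-Reasoning

n%2≡0⊎n%2≡1 : ∀ n → n % 2 ≡ 0 ⊎ n % 2 ≡ 1
n%2≡0⊎n%2≡1 n with n % 2 | m%n<n n 2
... | 0           | _ = inj₁ refl
... | 1           | _ = inj₂ refl
... | suc (suc _) | s≤s (s≤s ())

m+m≡m*2 : ∀ m → m + m ≡ m * 2
m+m≡m*2 m = trans (cong (m +_) (sym (+-identityʳ m))) (*-comm 2 m)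

even⇒n/2+n/2≡n : ∀ n → n % 2 ≡ 0 → n / 2 + n / 2 ≡ n
even⇒n/2+n/2≡n n even = sym (begin
  n                 ≡⟨ m≡m%n+[m/n]*n n 2 ⟩
  n % 2 + n / 2 * 2 ≡⟨ cong₂ _+_ even (sym (m+m≡m*2 (n / 2))) ⟩
  n / 2 + n / 2     ∎)
  where open ≡-Reasoning

odd⇒1+n/2+n/2≡n : ∀ n → n % 2 ≡ 1 → suc (n / 2 + n / 2) ≡ n
odd⇒1+n/2+n/2≡n n odd = sym (begin
  n                 ≡⟨ m≡m%n+[m/n]*n n 2 ⟩
  n % 2 + n / 2 * 2 ≡⟨ cong₂ _+_ odd (sym (m+m≡m*2 (n / 2))) ⟩
  suc (n / 2 + n / 2) ∎)
  where open ≡-Reasoning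

[m+m]/2≡m : ∀ m → (m + m) / 2 ≡ m
[m+m]/2≡m m = trans (cong (_/ 2) (m+m≡m*2 m)) (m*n/n≡m m 2)

[m+m]%2≡0 : ∀ m → (m + m) % 2 ≡ 0
[m+m]%2≡0 m = trans (cong (_% 2) (m+m≡m*2 m)) (m*n%n≡0 m 2)

[1+m+m]/2≡m : ∀ m → suc (m + m) / 2 ≡ m
[1+m+m]/2≡m m = trans (cong (λ k → suc k / 2) (m+m≡m*2 m))
  (trans (+-distrib-/ 1 (m * 2) (subst (λ k → 1 + k < 2) (sym (m*n%n≡0 m 2)) ≤-refl)) (m*n/n≡m m 2))

[1+m+m]%2≡1 : ∀ m → suc (m + m) % 2 ≡ 1
[1+m+m]%2≡1 m = trans (cong (λ k → suc k % 2) (m+m≡m*2 m))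
  (trans (%-distribˡ-+ 1 (m * 2) 2) (cong (λ k → (1 + k) % 2) (m*n%n≡0 m 2)))

even⇒1+n-odd : ∀ n → n % 2 ≡ 0 → suc n % 2 ≡ 1
even⇒1+n-odd n even = subst (λ k → suc k % 2 ≡ 1) (even⇒n/2+n/2≡n n even) ([1+m+m]%2≡1 (n / 2))

odd⇒1+n-even : ∀ n → n % 2 ≡ 1 → suc n % 2 ≡ 0
odd⇒1+n-even n odd = subst (λ k → suc k % 2 ≡ 0) (odd⇒1+n/2+n/2≡n n odd)
  (subst (λ k → k % 2 ≡ 0) (+-suc (suc (n / 2)) (n / 2)) ([m+m]%2≡0 (suc (n / 2))))

1+n-odd⇒even : ∀ n → suc n % 2 ≡ 1 → n % 2 ≡ 0
1+n-odd⇒even n odd′ with n%2≡0⊎n%2≡1 n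
... | inj₁ even = even
... | inj₂ odd with () ← trans (sym odd′) (odd⇒1+n-even n odd)

1+n-even⇒odd : ∀ n → suc n % 2 ≡ 0 → n % 2 ≡ 1
1+n-even⇒odd n even′ with n%2≡0⊎n%2≡1 n
... | inj₂ odd = odd
... | inj₁ even with () ← trans (sym (even⇒1+n-odd n even)) even′

odd⇒[n∸1]/2≡n/2 : ∀ n → n % 2 ≡ 1 → (n ∸ 1) / 2 ≡ n / 2
odd⇒[n∸1]/2≡n/2 n odd = begin
  (n ∸ 1) / 2                   ≡⟨ cong (λ k → (k ∸ 1) / 2) (sym n≡) ⟩
  (n / 2 + n / 2) / 2           ≡⟨ [m+m]/2≡m (n / 2) ⟩
  n / 2                         ≡⟨ sym ([1+m+m]/2≡m (n / 2)) ⟩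
  suc (n / 2 + n / 2) / 2       ≡⟨ cong (_/ 2) n≡ ⟩
  n / 2                         ∎
  where
  open ≡-Reasoning
  n≡ = odd⇒1+n/2+n/2≡n n odd

m+m≤n+n⇒m≤n : ∀ {m n} → m + m ≤ n + n → m ≤ n
m+m≤n+n⇒m≤n {m} {n} le = *-cancelʳ-≤ m n 2 (subst₂ _≤_ (m+m≡m*2 m) (m+m≡m*2 n) le)

n≡n%2+[n/2+n/2] : ∀ n → n ≡ n % 2 + (n / 2 + n / 2)
n≡n%2+[n/2+n/2] n = trans (m≡m%n+[m/n]*n n 2) (cong (n % 2 +_) (sym (m+m≡m*2 (n / 2))))

N∸N/2≡N%2+N/2 : ∀ N → N ∸ N / 2 ≡ N % 2 + N / 2
N∸N/2≡N%2+N/2 N = begin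
  N ∸ N / 2                       ≡⟨ cong (_∸ N / 2) (n≡n%2+[n/2+n/2] N) ⟩
  N % 2 + (N / 2 + N / 2) ∸ N / 2 ≡⟨ cong (_∸ N / 2) (sym (+-assoc (N % 2) (N / 2) (N / 2))) ⟩
  N % 2 + N / 2 + N / 2 ∸ N / 2   ≡⟨ m+n∸n≡m (N % 2 + N / 2) (N / 2) ⟩
  N % 2 + N / 2                   ∎
  where open ≡-Reasoning

-- cycDist pos u v unfolds to arcDist n ∣ pos u - pos v ∣.
arcDist : ℕ → ℕ → ℕ
arcDist N d = d ⊓ (N ∸ d)

arcDist-≤ : ∀ N d → arcDist N d ≤ d
arcDist-≤ N d = m⊓n≤m d (N ∸ d)

arcDist-complement : ∀ N d → d ≤ N → arcDist N (N ∸ d) ≡ arcDist N d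
arcDist-complement N d d≤N = trans (cong ((N ∸ d) ⊓_) (m∸[m∸n]≡n d≤N)) (⊓-comm (N ∸ d) d)

arcDist-short : ∀ N d → d + d ≤ N → arcDist N d ≡ d
arcDist-short N d 2d≤N = m≤n⇒m⊓n≡m (m+n≤o⇒m≤o∸n d 2d≤N)

arcDist≡⇒ : ∀ N d e → d ≤ N → arcDist N d ≡ e → d ≡ e ⊎ d ≡ N ∸ e
arcDist≡⇒ N d e d≤N eq with ≤-total d (N ∸ d)
... | inj₁ d≤ = inj₁ (trans (sym (m≤n⇒m⊓n≡m d≤)) eq)
... | inj₂ ≥d = inj₂ (trans (sym (m∸[m∸n]≡n d≤N)) (cong (N ∸_) (trans (sym (m≥n⇒m⊓n≡n ≥d)) eq)))

antipodal-offset : ∀ N e → e ≤ N → arcDist N e ≡ N / 2 → N / 2 ≤ e × e ≤ N % 2 + N / 2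
antipodal-offset N e e≤N e-antipodal with arcDist≡⇒ N e (N / 2) e≤N e-antipodal
... | inj₁ e≡H   = ≤-reflexive (sym e≡H) , ≤-trans (≤-reflexive e≡H) (m≤n+m (N / 2) (N % 2))
... | inj₂ e≡N-H = ≤-trans (m≤n+m (N / 2) (N % 2)) (≤-reflexive (sym e≡′)) , ≤-reflexive e≡′
  where e≡′ = trans e≡N-H (N∸N/2≡N%2+N/2 N)

∣m-n∣<o : ∀ {m n o} → m < o → n < o → ∣ m - n ∣ < o
∣m-n∣<o {m} {n} m<o n<o with ∣m-n∣≡[m∸n]∨[n∸m] m n
... | inj₁ eq = subst (_< _) (sym eq) (≤-<-trans (m∸n≤m m n) m<o)
... | inj₂ eq = subst (_< _) (sym eq) (≤-<-trans (m∸n≤m n m) n<o)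

[m%n+k]%n≡[m+k]%n : ∀ m k n .{{_ : NonZero n}} → (m % n + k) % n ≡ (m + k) % n
[m%n+k]%n≡[m+k]%n m k n = begin
  (m % n + k) % n         ≡⟨ %-distribˡ-+ (m % n) k n ⟩
  (m % n % n + k % n) % n ≡⟨ cong (λ x → (x + k % n) % n) (m%n%n≡m%n m n) ⟩
  (m % n + k % n) % n     ≡⟨ sym (%-distribˡ-+ m k n) ⟩
  (m + k) % n             ∎
  where open ≡-Reasoning

arcDist-step : ∀ N .{{_ : NonZero N}} x e → x < N → e ≤ N → arcDist N ∣ x - (x + e) % N ∣ ≡ arcDist N e
arcDist-step N x e x<N e≤N with x + e <? N
... | yes x+e<N = cong (arcDist N) (trans (cong (∣ x -_∣) (m<n⇒m%n≡m x+e<N)) (∣m-m+n∣≡n x e))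
... | no  x+e≮N = trans (cong (arcDist N) dist≡) (arcDist-complement N e e≤N)
  where
  y = x + e ∸ N
  y+N≡x+e : y + N ≡ x + e
  y+N≡x+e = m∸n+n≡m (≮⇒≥ x+e≮N)
  y<N : y < N
  y<N = +-cancelʳ-< N y N (subst (_< N + N) (sym y+N≡x+e) (+-mono-<-≤ x<N e≤N))
  x≡y+[N∸e] : x ≡ y + (N ∸ e)
  x≡y+[N∸e] = +-cancelʳ-≡ e x (y + (N ∸ e)) (begin
    x + e             ≡⟨ sym y+N≡x+e ⟩
    y + N             ≡⟨ cong (y +_) (sym (m∸n+n≡m e≤N)) ⟩
    y + (N ∸ e + e)   ≡⟨ sym (+-assoc y (N ∸ e) e) ⟩
    y + (N ∸ e) + e   ∎)
    where open ≡-Reasoning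
  dist≡ : ∣ x - (x + e) % N ∣ ≡ N ∸ e
  dist≡ = begin
    ∣ x - (x + e) % N ∣     ≡⟨ cong (∣ x -_∣) (trans (cong (_% N) (sym y+N≡x+e))
                                                 (trans ([m+n]%n≡m%n y N) (m<n⇒m%n≡m y<N))) ⟩
    ∣ x - y ∣               ≡⟨ cong (∣_- y ∣) x≡y+[N∸e] ⟩
    ∣ y + (N ∸ e) - y ∣     ≡⟨ ∣-∣-comm (y + (N ∸ e)) y ⟩
    ∣ y - y + (N ∸ e) ∣     ≡⟨ ∣m-m+n∣≡n y (N ∸ e) ⟩
    N ∸ e                   ∎
    where open ≡-Reasoning

arcDist-shift : ∀ N .{{_ : NonZero N}} c i e → e ≤ N →
  arcDist N ∣ (c + i) % N - (c + (i + e)) % N ∣ ≡ arcDist N e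
arcDist-shift N c i e e≤N = begin
  arcDist N ∣ (c + i) % N - (c + (i + e)) % N ∣
    ≡⟨ cong (λ x → arcDist N ∣ (c + i) % N - x ∣)
         (trans (cong (_% N) (sym (+-assoc c i e))) (sym ([m%n+k]%n≡[m+k]%n (c + i) e N))) ⟩
  arcDist N ∣ (c + i) % N - ((c + i) % N + e) % N ∣
    ≡⟨ arcDist-step N ((c + i) % N) e (m%n<n (c + i) N) e≤N ⟩
  arcDist N e ∎
  where open ≡-Reasoning

cycDist-sym : ∀ {N} (pos : CyclePos N) u v → cycDist pos u v ≡ cycDist pos v u
cycDist-sym {N} pos u v = cong (arcDist N) (∣-∣-comm (toℕ (pos u)) (toℕ (pos v)))

cycDist-self : ∀ {N} (pos : CyclePos N) u → cycDist pos u u ≡ 0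
cycDist-self {N} pos u = cong (arcDist N) (∣n-n∣≡0 (toℕ (pos u)))

module CycleCounting {N} .{{_ : NonZero N}} (pos : CyclePos N) (pos-inj : Injective _≡_ _≡_ pos) where

  private
    P : Fin N → ℕ
    P u = toℕ (pos u)

    P-injective : ∀ {u v} → P u ≡ P v → u ≡ v
    P-injective eq = pos-inj (toℕ-injective eq)

    ∣P-P∣≤N : ∀ u v → ∣ P u - P v ∣ ≤ N
    ∣P-P∣≤N u v = <⇒≤ (∣m-n∣<o (toℕ<n (pos u)) (toℕ<n (pos v)))

  cycDist≡0⇒≡ : ∀ u v → cycDist pos u v ≡ 0 → u ≡ v
  cycDist≡0⇒≡ u v eq with arcDist≡⇒ N ∣ P u - P v ∣ 0 (∣P-P∣≤N u v) eq
  ... | inj₁ ∣u-v∣≡0 = P-injective (∣m-n∣≡0⇒m≡n ∣u-v∣≡0)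
  ... | inj₂ ∣u-v∣≡N = ⊥-elim (<-irrefl ∣u-v∣≡N (∣m-n∣<o (toℕ<n (pos u)) (toℕ<n (pos v))))

  private
    position-from-difference : ∀ a b → a < N → b < N →
      b ≡ (a + ∣ a - b ∣) % N ⊎ b ≡ (a + (N ∸ ∣ a - b ∣)) % N
    position-from-difference a b a<N b<N with ≤-total a b
    ... | inj₁ a≤b = inj₁ (sym (begin
      (a + ∣ a - b ∣) % N ≡⟨ cong (λ x → (a + x) % N) (m≤n⇒∣m-n∣≡n∸m a≤b) ⟩
      (a + (b ∸ a)) % N   ≡⟨ cong (_% N) (m+[n∸m]≡n a≤b) ⟩
      b % N               ≡⟨ m<n⇒m%n≡m b<N ⟩
      b                   ∎))
      where open ≡-Reasoning
    ... | inj₂ b≤a = inj₂ (sym (begin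
      (a + (N ∸ ∣ a - b ∣)) % N           ≡⟨ cong (λ x → (a + (N ∸ x)) % N) (m≤n⇒∣n-m∣≡n∸m b≤a) ⟩
      (a + (N ∸ (a ∸ b))) % N             ≡⟨ cong (λ x → (x + (N ∸ (a ∸ b))) % N) (sym (m+[n∸m]≡n b≤a)) ⟩
      (b + (a ∸ b) + (N ∸ (a ∸ b))) % N   ≡⟨ cong (_% N) (trans (+-assoc b _ _)
                                               (cong (b +_) (m+[n∸m]≡n (≤-trans (m∸n≤m a b) (<⇒≤ a<N))))) ⟩
      (b + N) % N                         ≡⟨ [m+n]%n≡m%n b N ⟩
      b % N                               ≡⟨ m<n⇒m%n≡m b<N ⟩
      b                                   ∎))
      where open ≡-Reasoning

  cycDist≡⇒position : ∀ u v d → cycDist pos u v ≡ d →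
    P v ≡ (P u + d) % N ⊎ P v ≡ (P u + (N ∸ d)) % N
  cycDist≡⇒position u v d eq
    with arcDist≡⇒ N ∣ P u - P v ∣ d (∣P-P∣≤N u v) eq
       | position-from-difference (P u) (P v) (toℕ<n (pos u)) (toℕ<n (pos v))
  ... | inj₁ diff≡d | inj₁ after  = inj₁ (trans after (cong (λ x → (P u + x) % N) diff≡d))
  ... | inj₁ diff≡d | inj₂ before = inj₂ (trans before (cong (λ x → (P u + (N ∸ x)) % N) diff≡d))
  ... | inj₂ diff≡  | inj₁ after  = inj₂ (trans after (cong (λ x → (P u + x) % N) diff≡))
  ... | inj₂ diff≡  | inj₂ before = inj₁ (trans before
        (cong (λ x → (P u + x) % N) (trans (cong (N ∸_) diff≡) (m∸[m∸n]≡n d≤N))))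
    where d≤N = ≤-trans (subst (_≤ ∣ P u - P v ∣) eq (arcDist-≤ N _)) (∣P-P∣≤N u v)

  private
    atPosition-≤1 : ∀ p → ∑[ v < N ] 𝟙 (P v ≡ᵇ p) ≤ 1
    atPosition-≤1 p = ∑-𝟙-unique-≤1 (λ v → P v ≡ᵇ p)
      λ i j pi pj → P-injective (trans (≡ᵇ-sound pi) (sym (≡ᵇ-sound pj)))

  atDistance-≤2 : ∀ u d → ∑[ v < N ] 𝟙 (cycDist pos u v ≡ᵇ d) ≤ 2
  atDistance-≤2 u d = begin
    ∑[ v < N ] 𝟙 (cycDist pos u v ≡ᵇ d)
      ≤⟨ ∑-mono-≤ {N} (λ v → 𝟙-≤-+ λ eq →
           Sum.map (𝟙-true ∘ ≡ᵇ-true) (𝟙-true ∘ ≡ᵇ-true) (cycDist≡⇒position u v d (≡ᵇ-sound eq))) ⟩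
    ∑[ v < N ] (𝟙 (P v ≡ᵇ (P u + d) % N) + 𝟙 (P v ≡ᵇ (P u + (N ∸ d)) % N))
      ≡⟨ ∑-distrib-+ {N} _ _ ⟩
    ∑[ v < N ] 𝟙 (P v ≡ᵇ (P u + d) % N) + ∑[ v < N ] 𝟙 (P v ≡ᵇ (P u + (N ∸ d)) % N)
      ≤⟨ +-mono-≤ (atPosition-≤1 _) (atPosition-≤1 _) ⟩
    2 ∎
    where open ≤-Reasoning

  antipodal-≤1 : N % 2 ≡ 0 → ∀ u → ∑[ v < N ] 𝟙 (cycDist pos u v ≡ᵇ N / 2) ≤ 1
  antipodal-≤1 even u = ≤-trans (∑-mono-≤ {N} λ v → 𝟙-≤-𝟙 λ eq → ≡ᵇ-true (onePosition v (≡ᵇ-sound eq)))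
                                (atPosition-≤1 _)
    where
    N∸N/2≡N/2 : N ∸ N / 2 ≡ N / 2
    N∸N/2≡N/2 = trans (N∸N/2≡N%2+N/2 N) (cong (_+ N / 2) even)
    onePosition : ∀ v → cycDist pos u v ≡ N / 2 → P v ≡ (P u + N / 2) % N
    onePosition v eq with cycDist≡⇒position u v (N / 2) eq
    ... | inj₁ after  = after
    ... | inj₂ before = trans before (cong (λ x → (P u + x) % N) N∸N/2≡N/2)

  antipodal-pairs-≤ : N % 2 ≡ 0 → countPairs N (λ x y → cycDist pos x y ≡ᵇ N / 2) ≤ N / 2
  antipodal-pairs-≤ even = m+m≤n+n⇒m≤n (begin
    countPairs N A + countPairs N A
      ≡⟨ countPairs-handshake N A (λ x y → cong (_≡ᵇ N / 2) (cycDist-sym pos x y)) A-irrefl ⟩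
    ∑[ x < N ] ∑[ y < N ] 𝟙 (A x y)
      ≤⟨ ∑-mono-≤ {N} (antipodal-≤1 even) ⟩
    ∑[ x < N ] 1
      ≡⟨ trans (∑-const N 1) (*-identityʳ N) ⟩
    N
      ≡⟨ sym (even⇒n/2+n/2≡n N even) ⟩
    N / 2 + N / 2 ∎)
    where
    open ≤-Reasoning
    A : Fin N → Fin N → Bool
    A x y = cycDist pos x y ≡ᵇ N / 2
    A-irrefl : ∀ x → A x x ≡ false
    A-irrefl x with A x x in eq
    ... | false = refl
    ... | true  = ⊥-elim (n≮0 (subst (toℕ x <_) N≡0 (toℕ<n x)))
      where
      N/2≡0 = trans (sym (≡ᵇ-sound eq)) (cycDist-self pos x)
      N≡0 = trans (sym (even⇒n/2+n/2≡n N even)) (cong (λ k → k + k) N/2≡0)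

  near : ℕ → Fin N → Fin N → ℕ
  near h u v = ∑[ j < h ] 𝟙 (cycDist pos u v ≡ᵇ suc (toℕ j))

  ∑-near-≤ : ∀ h u → ∑[ v < N ] near h u v ≤ h * 2
  ∑-near-≤ h u = begin
    ∑[ v < N ] near h u v
      ≡⟨ ∑-comm {N} {h} (λ v j → 𝟙 (cycDist pos u v ≡ᵇ suc (toℕ j))) ⟩
    ∑[ j < h ] ∑[ v < N ] 𝟙 (cycDist pos u v ≡ᵇ suc (toℕ j))
      ≤⟨ ∑-mono-≤ {h} (λ j → atDistance-≤2 u (suc (toℕ j))) ⟩
    ∑[ j < h ] 2
      ≡⟨ ∑-const h 2 ⟩
    h * 2 ∎
    where open ≤-Reasoning

  near-pos : ∀ h u v → u ≢ v → cycDist pos u v ≤ h → 1 ≤ near h u v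
  near-pos h u v u≢v d≤h with cycDist pos u v in eq
  ... | zero  = ⊥-elim (u≢v (cycDist≡0⇒≡ u v eq))
  ... | suc d = hit h d d≤h
    where
    hit : ∀ h d → d < h → 1 ≤ ∑[ j < h ] 𝟙 (suc d ≡ᵇ suc (toℕ j))
    hit (suc h) zero    _         = s≤s z≤n
    hit (suc h) (suc d) (s≤s d<h) = ≤-trans (hit h d d<h) (m≤n+m _ (𝟙 (suc (suc d) ≡ᵇ 1)))

surjective : ∀ {n} (f : Fin n → Fin n) → Injective _≡_ _≡_ f → ∀ y → ∃ λ x → f x ≡ y
surjective {zero}  f f-inj ()
surjective {suc n} f f-inj y with any? (λ x → f x ≟ᶠ y)
... | yes found = found
... | no  none  = ⊥-elim (<-irrefl refl (injective⇒≤ g-inj))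
  where
  y≢f : ∀ x → y ≢ f x
  y≢f x eq = none (x , sym eq)
  g : Fin (suc n) → Fin n
  g x = punchOut (y≢f x)
  g-inj : Injective _≡_ _≡_ g
  g-inj eq = f-inj (punchOut-injective (y≢f _) (y≢f _) eq)

antipode : ∀ {N} .{{_ : NonZero N}} (pos : CyclePos N) → Injective _≡_ _≡_ pos →
  ∀ u → ∃ λ v → cycDist pos u v ≡ N / 2
antipode {N} pos pos-inj u = v , (begin
  arcDist N ∣ toℕ (pos u) - toℕ (pos v) ∣             ≡⟨ cong (λ x → arcDist N ∣ toℕ (pos u) - x ∣) P-v ⟩
  arcDist N ∣ toℕ (pos u) - (toℕ (pos u) + N / 2) % N ∣
    ≡⟨ arcDist-step N (toℕ (pos u)) (N / 2) (toℕ<n (pos u)) (m/n≤m N 2) ⟩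
  arcDist N (N / 2)
    ≡⟨ arcDist-short N (N / 2) (≤-trans (m≤n+m _ (N % 2)) (≤-reflexive (sym (n≡n%2+[n/2+n/2] N)))) ⟩
  N / 2                                               ∎)
  where
  open ≡-Reasoning
  target = fromℕ< (m%n<n (toℕ (pos u) + N / 2) N)
  v = proj₁ (surjective pos pos-inj target)
  P-v : toℕ (pos v) ≡ (toℕ (pos u) + N / 2) % N
  P-v = trans (cong toℕ (proj₂ (surjective pos pos-inj target))) (toℕ-fromℕ< _)

-- Every node has at most 2h neighbours within distance h and at most 2 at distance D.
numLinks-bound : ∀ {N} .{{_ : NonZero N}} (pos : CyclePos N) → Injective _≡_ _≡_ pos → (G : Graph N) → ∀ h D →
  (∀ u v → Linked G u v → (u ≢ v × cycDist pos u v ≤ h) ⊎ cycDist pos u v ≡ D) →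
  numLinks G + numLinks G ≤ N * (h * 2 + 2)
numLinks-bound {N} pos pos-inj G h D links = begin
  numLinks G + numLinks G
    ≡⟨ cong₂ _+_ (numLinks≡countPairs G) (numLinks≡countPairs G) ⟩
  countPairs N (adj G) + countPairs N (adj G)
    ≡⟨ countPairs-handshake N (adj G) (adj-sym G) (adj-irrefl G) ⟩
  ∑[ u < N ] ∑[ v < N ] 𝟙 (adj G u v)
    ≤⟨ ∑-mono-≤ {N} degree-≤ ⟩
  ∑[ u < N ] (h * 2 + 2)
    ≡⟨ ∑-const N _ ⟩
  N * (h * 2 + 2) ∎
  where
  open ≤-Reasoning
  open CycleCounting pos pos-inj
  degree-≤ : ∀ u → ∑[ v < N ] 𝟙 (adj G u v) ≤ h * 2 + 2
  degree-≤ u = begin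
    ∑[ v < N ] 𝟙 (adj G u v)
      ≤⟨ ∑-mono-≤ {N} (λ v → 𝟙-≤-+ λ l →
           Sum.map (λ (u≢v , d≤h) → near-pos h u v u≢v d≤h) (𝟙-true ∘ ≡ᵇ-true) (links u v l)) ⟩
    ∑[ v < N ] (near h u v + 𝟙 (cycDist pos u v ≡ᵇ D))
      ≡⟨ ∑-distrib-+ {N} _ _ ⟩
    ∑[ v < N ] near h u v + ∑[ v < N ] 𝟙 (cycDist pos u v ≡ᵇ D)
      ≤⟨ +-mono-≤ (∑-near-≤ h u) (atDistance-≤2 u D) ⟩
    h * 2 + 2 ∎

shiftAt-∣-∣ : ∀ p a b →
  ∣ shiftAt p a - shiftAt p b ∣ ≡ ∣ a - b ∣ ⊎ ∣ shiftAt p a - shiftAt p b ∣ ≡ suc ∣ a - b ∣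
shiftAt-∣-∣ p a b with a <ᵇ p in ea | b <ᵇ p in eb
... | true  | true  = inj₁ refl
... | false | false = inj₁ refl
... | true  | false = inj₂ (trans (m≤n⇒∣m-n∣≡n∸m (m≤n⇒m≤1+n a≤b))
                              (trans (+-∸-assoc 1 a≤b) (cong suc (sym (m≤n⇒∣m-n∣≡n∸m a≤b)))))
  where a≤b = ≤-trans (<⇒≤ (<ᵇ-sound a p ea)) (<ᵇ-false⇒≥ b p eb)
... | false | true  = inj₂ (trans (m≤n⇒∣n-m∣≡n∸m (m≤n⇒m≤1+n b≤a))
                              (trans (+-∸-assoc 1 b≤a) (cong suc (sym (m≤n⇒∣n-m∣≡n∸m b≤a)))))
  where b≤a = ≤-trans (<⇒≤ (<ᵇ-sound b p eb)) (<ᵇ-false⇒≥ a p ea)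

shiftAt≢ : ∀ p a → shiftAt p a ≢ p
shiftAt≢ p a with a <ᵇ p in ea
... | true  = λ eq → <-irrefl eq (<ᵇ-sound a p ea)
... | false = λ eq → <-irrefl (sym eq) (s≤s (<ᵇ-false⇒≥ a p ea))

shiftAt-injective : ∀ p {a b} → shiftAt p a ≡ shiftAt p b → a ≡ b
shiftAt-injective p {a} {b} eq with shiftAt-∣-∣ p a b
... | inj₁ same = ∣m-n∣≡0⇒m≡n (trans (sym same) diff≡0)
  where diff≡0 = trans (cong (∣_- shiftAt p b ∣) eq) (∣n-n∣≡0 (shiftAt p b))
... | inj₂ more with () ← trans (sym more) (trans (cong (∣_- shiftAt p b ∣) eq) (∣n-n∣≡0 (shiftAt p b)))

arcDist-insert-≤ : ∀ n d d′ → d ≤ n → d′ ≡ d ⊎ d′ ≡ suc d → arcDist n d ≤ arcDist (suc n) d′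
arcDist-insert-≤ n d .d       d≤n (inj₁ refl) = ⊓-monoʳ-≤ d (∸-monoˡ-≤ d (n≤1+n n))
arcDist-insert-≤ n d .(suc d) d≤n (inj₂ refl) = ⊓-monoˡ-≤ (n ∸ d) (n≤1+n d)

arcDist-insert-antipodal : ∀ m d d′ → d ≤ m + m → arcDist (m + m) d ≡ m →
  d′ ≡ d ⊎ d′ ≡ suc d → arcDist (suc (m + m)) d′ ≡ m
arcDist-insert-antipodal m d d′ d≤2m eq = stretched (d≡m (arcDist≡⇒ (m + m) d m d≤2m eq))
  where
  d≡m : d ≡ m ⊎ d ≡ m + m ∸ m → d ≡ m
  d≡m (inj₁ d≡m)   = d≡m
  d≡m (inj₂ d≡2m-m) = trans d≡2m-m (m+n∸n≡m m m)
  stretched : d ≡ m → d′ ≡ d ⊎ d′ ≡ suc d → arcDist (suc (m + m)) d′ ≡ m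
  stretched refl (inj₁ refl) =
    trans (cong (d ⊓_) (trans (+-∸-assoc 1 (m≤n+m d d)) (cong suc (m+n∸n≡m d d)))) (m≤n⇒m⊓n≡m (n≤1+n d))
  stretched refl (inj₂ refl) = trans (cong (suc d ⊓_) (m+n∸n≡m d d)) (m≥n⇒m⊓n≡n (n≤1+n d))

linked-sym : ∀ {n} (G : Graph n) {u v} → Linked G u v → Linked G v u
linked-sym G {u} {v} l = trans (adj-sym G v u) l

module _ {n} {G : Graph n} {S : Subset n} where

  _++ᵖ_ : ∀ {u v w} → PathAvoiding G S u v → PathAvoiding G S v w → PathAvoiding G S u w
  here         ++ᵖ q = q
  step l v∉S p ++ᵖ q = step l v∉S (p ++ᵖ q)

  reverseᵖ : ∀ {u w} → u ∉ S → PathAvoiding G S u w → PathAvoiding G S w u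
  reverseᵖ u∉S here           = here
  reverseᵖ u∉S (step l v∉S p) = reverseᵖ v∉S p ++ᵖ step (linked-sym G l) u∉S here

∣S∣≡∑ : ∀ {n} (S : Subset n) → ∣ S ∣ ≡ ∑[ x < n ] 𝟙 (lookup S x)
∣S∣≡∑ []          = refl
∣S∣≡∑ (true ∷ S)  = cong suc (∣S∣≡∑ S)
∣S∣≡∑ (false ∷ S) = ∣S∣≡∑ S

segmentSum : ℕ → ℕ → (ℕ → ℕ) → ℕ
segmentSum a zero    g = 0
segmentSum a (suc l) g = g a + segmentSum (suc a) l g

∑≡segmentSum : ∀ n a (g : ℕ → ℕ) → ∑[ i < n ] g (a + toℕ i) ≡ segmentSum a n g
∑≡segmentSum zero    a g = refl
∑≡segmentSum (suc n) a g = cong₂ _+_ (cong g (+-identityʳ a))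
  (trans (sum-cong-≗ {n} (λ i → cong g (+-suc a (toℕ i)))) (∑≡segmentSum n (suc a) g))

segmentSum-++ : ∀ a l₁ l₂ g → segmentSum a (l₁ + l₂) g ≡ segmentSum a l₁ g + segmentSum (a + l₁) l₂ g
segmentSum-++ a zero     l₂ g = cong (λ b → segmentSum b l₂ g) (sym (+-identityʳ a))
segmentSum-++ a (suc l₁) l₂ g = trans
  (cong (g a +_) (trans (segmentSum-++ (suc a) l₁ l₂ g)
                        (cong (λ b → segmentSum (suc a) l₁ g + segmentSum b l₂ g) (sym (+-suc a l₁)))))
  (sym (+-assoc (g a) _ _))

segmentSum-++₅ : ∀ a l₁ l₂ l₃ l₄ l₅ g →
  segmentSum a (l₁ + (l₂ + (l₃ + (l₄ + l₅)))) g ≡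
    segmentSum a l₁ g + (segmentSum (a + l₁) l₂ g + (segmentSum (a + l₁ + l₂) l₃ g +
      (segmentSum (a + l₁ + l₂ + l₃) l₄ g + segmentSum (a + l₁ + l₂ + l₃ + l₄) l₅ g)))
segmentSum-++₅ a l₁ l₂ l₃ l₄ l₅ g =
  trans (segmentSum-++ a l₁ _ g) (cong (segmentSum a l₁ g +_)
  (trans (segmentSum-++ (a + l₁) l₂ _ g) (cong (segmentSum (a + l₁) l₂ g +_)
  (trans (segmentSum-++ (a + l₁ + l₂) l₃ _ g) (cong (segmentSum (a + l₁ + l₂) l₃ g +_)
  (segmentSum-++ (a + l₁ + l₂ + l₃) l₄ l₅ g))))))

segmentSum≡0 : ∀ a l g → segmentSum a l g ≡ 0 → ∀ k → k < l → g (a + k) ≡ 0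
segmentSum≡0 a (suc l) g eq zero    _         = trans (cong g (+-identityʳ a)) (m+n≡0⇒m≡0 (g a) eq)
segmentSum≡0 a (suc l) g eq (suc k) (s≤s k<l) =
  trans (cong g (+-suc a k)) (segmentSum≡0 (suc a) l g (m+n≡0⇒n≡0 (g a) eq) k k<l)

segmentSum-ones : ∀ a l g → (∀ k → k < l → g (a + k) ≡ 1) → segmentSum a l g ≡ l
segmentSum-ones a zero    g ones = refl
segmentSum-ones a (suc l) g ones = cong₂ _+_ (trans (cong g (sym (+-identityʳ a))) (ones 0 (s≤s z≤n)))
  (segmentSum-ones (suc a) l g (λ k k<l → trans (cong g (sym (+-suc a k))) (ones (suc k) (s≤s k<l))))

searchInterval : (Q : ℕ → Set) → (∀ r → Dec (Q r)) → ∀ a k →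
  (∃ λ r → a < r × r ≤ a + k × Q r) ⊎ (∀ r → a < r → r ≤ a + k → ¬ Q r)
searchInterval Q Q? a zero = inj₂ λ r a<r r≤a+0 _ → <-irrefl refl (<-≤-trans a<r (subst (r ≤_) (+-identityʳ a) r≤a+0))
searchInterval Q Q? a (suc k) with Q? (a + suc k)
... | yes q = inj₁ (a + suc k , m<m+n a (s≤s z≤n) , ≤-refl , q)
... | no ¬q with searchInterval Q Q? a k
...   | inj₁ (r , a<r , r≤a+k , q) = inj₁ (r , a<r , ≤-trans r≤a+k (+-monoʳ-≤ a (n≤1+n k)) , q)
...   | inj₂ none = inj₂ none′
  where
  none′ : ∀ r → a < r → r ≤ a + suc k → ¬ Q r
  none′ r a<r r≤ with r ≟ a + suc k
  ... | yes refl = ¬q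
  ... | no  r≢   = none r a<r (<⇒≤pred (subst (r <_) (+-suc a k) (≤∧≢⇒< r≤ r≢)))

-- A cycle split into arcs of α and β nodes by two gaps of h nodes: if the first arc is the
-- shorter one, every position at cycle distance N/2 from its first node lies in the second arc.
antipode-in-longer-arc : ∀ N α β h e →
  N ≡ α + (h + (β + h)) → α + N % 2 ≤ β → h + h + 3 ≤ N → e ≤ N → arcDist N e ≡ N / 2 →
  ∃ λ k → e ≡ α + h + k × k < β
antipode-in-longer-arc N α β h e N≡ α+r≤β 2h+3≤N e≤N e-antipodal = e ∸ (α + h) , e≡ , k<β
  where
  open ≤-Reasoning
  r = N % 2
  H = N / 2
  N≡r+2H = n≡n%2+[n/2+n/2] N
  α+h≤H : α + h ≤ H
  α+h≤H = m+m≤n+n⇒m≤n (+-cancelˡ-≤ r _ _ (begin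
    r + ((α + h) + (α + h))   ≡⟨ rearrange₁ r α h ⟩
    (α + r) + (h + (α + h))   ≤⟨ +-monoˡ-≤ _ α+r≤β ⟩
    β + (h + (α + h))         ≡⟨ rearrange₂ α β h ⟩
    α + (h + (β + h))         ≡⟨ trans (sym N≡) N≡r+2H ⟩
    r + (H + H)               ∎))
    where
    rearrange₁ : ∀ r α h → r + ((α + h) + (α + h)) ≡ (α + r) + (h + (α + h))
    rearrange₁ = solve-∀
    rearrange₂ : ∀ α β h → β + (h + (α + h)) ≡ α + (h + (β + h))
    rearrange₂ = solve-∀
  h<H : h < H
  h<H = m+m≤n+n⇒m≤n (≤-pred (begin
    suc (suc h + suc h)       ≡⟨ rearrange h ⟩
    h + h + 3                 ≤⟨ 2h+3≤N ⟩
    N                         ≡⟨ N≡r+2H ⟩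
    r + (H + H)               ≤⟨ +-monoˡ-≤ (H + H) (≤-pred (m%n<n N 2)) ⟩
    suc (H + H)               ∎))
    where
    rearrange : ∀ h → suc (suc h + suc h) ≡ h + h + 3
    rearrange = solve-∀
  e≡ : e ≡ α + h + (e ∸ (α + h))
  e≡ = sym (m+[n∸m]≡n (≤-trans α+h≤H (proj₁ (antipodal-offset N e e≤N e-antipodal))))
  k<β : e ∸ (α + h) < β
  k<β = +-cancelˡ-< (α + h) _ β (+-cancelʳ-< h _ (α + h + β) (begin-strict
    α + h + (e ∸ (α + h)) + h ≡⟨ cong (_+ h) (sym e≡) ⟩
    e + h                     ≤⟨ +-monoˡ-≤ h (proj₂ (antipodal-offset N e e≤N e-antipodal)) ⟩
    r + H + h                 <⟨ +-monoʳ-< (r + H) h<H ⟩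
    r + H + H                 ≡⟨ trans (+-assoc r H H) (sym N≡r+2H) ⟩
    N                         ≡⟨ trans N≡ (rearrange α β h) ⟩
    α + h + β + h             ∎))
    where
    rearrange : ∀ α β h → α + (h + (β + h)) ≡ α + h + β + h
    rearrange = solve-∀

shorter-arc : ∀ N α β h → N ≡ α + (h + (β + h)) → α + N % 2 ≤ β ⊎ β + N % 2 ≤ α
shorter-arc N α β h N≡ with n%2≡0⊎n%2≡1 N
... | inj₁ even rewrite even = Sum.map (subst (_≤ β) (sym (+-identityʳ α)))
                                            (subst (_≤ α) (sym (+-identityʳ β))) (≤-total α β)
... | inj₂ odd rewrite odd with <-cmp α β
...   | tri< α<β _ _ = inj₁ (subst (_≤ β) (+-comm 1 α) α<β)
...   | tri> _ _ β<α = inj₂ (subst (_≤ α) (+-comm 1 β) β<α)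
...   | tri≈ _ refl _ = ⊥-elim (0≢1+n (begin
  0                         ≡⟨ sym ([m+m]%2≡0 (α + h)) ⟩
  (α + h + (α + h)) % 2     ≡⟨ cong (_% 2) (trans (+-assoc α h (α + h)) (sym N≡)) ⟩
  N % 2                     ≡⟨ odd ⟩
  1                         ∎))
  where open ≡-Reasoning

module Robustness {N} .{{_ : NonZero N}} (h : ℕ) (2h+3≤N : h + h + 3 ≤ N) (1≤h : 1 ≤ h)
  (G : Graph N) (pos inv : CyclePos N)
  (pos∘inv : ∀ y → pos (inv y) ≡ y) (inv∘pos : ∀ x → inv (pos x) ≡ x)
  (short : ∀ u v → u ≢ v → cycDist pos u v ≤ h → Linked G u v)
  (diameter : ∀ u → ∃ λ v → cycDist pos u v ≡ N / 2 × Linked G u v)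
  (S : Subset N) where

  Path : Fin N → Fin N → Set
  Path = PathAvoiding G S

  P : Fin N → ℕ
  P y = toℕ (pos y)

  -- Positions on the cycle are handled as natural numbers c + i, read modulo N.
  node : ℕ → ℕ → Fin N
  node c i = inv (fromℕ< (m%n<n (c + i) N))

  P-node : ∀ c i → P (node c i) ≡ (c + i) % N
  P-node c i = trans (cong toℕ (pos∘inv _)) (toℕ-fromℕ< _)

  node-cong : ∀ c i c′ i′ → (c + i) % N ≡ (c′ + i′) % N → node c i ≡ node c′ i′
  node-cong c i c′ i′ eq = cong inv (toℕ-injective (trans (toℕ-fromℕ< _) (trans eq (sym (toℕ-fromℕ< _)))))

  node-rebase : ∀ c x i → node ((c + x) % N) i ≡ node c (x + i)
  node-rebase c x i = node-cong _ i c (x + i) (trans ([m%n+k]%n≡[m+k]%n (c + x) i N) (cong (_% N) (+-assoc c x i)))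

  node-wrap : ∀ c i → node c (N + i) ≡ node c i
  node-wrap c i = node-cong c (N + i) c i
    (trans (cong (_% N) (trans (sym (+-assoc c N i)) (trans (cong (_+ i) (+-comm c N)) (+-assoc N c i))))
           (trans (cong (_% N) (+-comm N (c + i))) ([m+n]%n≡m%n (c + i) N)))

  node-P : ∀ y → node (P y) 0 ≡ y
  node-P y = trans (cong inv (toℕ-injective (trans (toℕ-fromℕ< _)
                     (trans (cong (_% N) (+-identityʳ (P y))) (m<n⇒m%n≡m (toℕ<n (pos y))))))) (inv∘pos y)

  offset : ℕ → Fin N → ℕ
  offset c y = (P y + (N ∸ c)) % N

  node-offset : ∀ c y → c ≤ N → node c (offset c y) ≡ y
  node-offset c y c≤N = trans (node-cong c (offset c y) (P y) 0 eq) (node-P y)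
    where
    eq : (c + offset c y) % N ≡ (P y + 0) % N
    eq = begin
      (c + (P y + (N ∸ c)) % N) % N ≡⟨ trans (cong (_% N) (+-comm c _))
                                          (trans ([m%n+k]%n≡[m+k]%n _ c N) (cong (_% N) (+-comm _ c))) ⟩
      (c + (P y + (N ∸ c))) % N     ≡⟨ cong (_% N) (solve≡ c (P y) (N ∸ c)) ⟩
      (P y + (c + (N ∸ c))) % N     ≡⟨ cong (λ x → (P y + x) % N) (m+[n∸m]≡n c≤N) ⟩
      (P y + N) % N                 ≡⟨ [m+n]%n≡m%n (P y) N ⟩
      P y % N                       ≡⟨ cong (_% N) (sym (+-identityʳ (P y))) ⟩
      (P y + 0) % N                 ∎
      where
      open ≡-Reasoning
      solve≡ : ∀ a b d → a + (b + d) ≡ b + (a + d)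
      solve≡ = solve-∀

  offset<N : ∀ c y → offset c y < N
  offset<N c y = m%n<n _ N

  cycDist-node : ∀ c i e → e ≤ N → cycDist pos (node c i) (node c (i + e)) ≡ arcDist N e
  cycDist-node c i e e≤N = trans (cong₂ (λ a b → arcDist N ∣ a - b ∣) (P-node c i) (P-node c (i + e)))
                                 (arcDist-shift N c i e e≤N)

  h<N : h < N
  h<N = ≤-trans (s≤s (m≤m+n h h)) (≤-trans (m≤m+n (suc (h + h)) 2) (≤-trans (≤-reflexive (sym (+-suc (h + h) 2))) 2h+3≤N))

  linked-node : ∀ c i e → 1 ≤ e → e ≤ h → Linked G (node c i) (node c (i + e))
  linked-node c i e 1≤e e≤h =
    short _ _ distinct (≤-trans (≤-reflexive (cycDist-node c i e e≤N)) (≤-trans (arcDist-≤ N e) e≤h))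
    where
    e≤N = ≤-trans e≤h (<⇒≤ h<N)
    2e≤N = ≤-trans (+-mono-≤ e≤h e≤h) (≤-trans (m≤m+n (h + h) 3) 2h+3≤N)
    distinct : node c i ≢ node c (i + e)
    distinct eq = <-irrefl (sym (begin
      e                                         ≡⟨ sym (arcDist-short N e 2e≤N) ⟩
      arcDist N e                               ≡⟨ sym (cycDist-node c i e e≤N) ⟩
      cycDist pos (node c i) (node c (i + e))   ≡⟨ cong (cycDist pos (node c i)) (sym eq) ⟩
      cycDist pos (node c i) (node c i)         ≡⟨ cycDist-self pos (node c i) ⟩
      0                                         ∎)) 1≤e
      where open ≡-Reasoning

  Alive : ℕ → ℕ → Set
  Alive c i = node c i ∉ S

  alive? : ∀ c i → Dec (Alive c i)
  alive? c i = ¬? (node c i ∈? S)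

  Gap : ℕ → ℕ → Set
  Gap c s = ∀ r → s < r → r ≤ s + h → ¬ Alive c r

  hop : ∀ c {i m} → i ≤ m → m ≤ i + h → Alive c m → Path (node c i) (node c m)
  hop c {i} i≤m m≤i+h am with m≤n⇒∃[o]m+o≡n i≤m
  ... | zero  , refl = subst (λ x → Path (node c i) (node c x)) (sym (+-identityʳ i)) here
  ... | suc e , refl = step (linked-node c i (suc e) (s≤s z≤n) (+-cancelˡ-≤ i (suc e) h m≤i+h)) am here

  walk : ∀ c {i m} → i ≤ m → Alive c i → Alive c m →
    Path (node c i) (node c m) ⊎ ∃ λ s → i ≤ s × s + h < m × Gap c s
  walk c {i} {m} i≤m ai am = go (m ∸ i) ≤-refl i≤m ai
    where
    go : ∀ fuel {i} → m ∸ i ≤ fuel → i ≤ m → Alive c i →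
      Path (node c i) (node c m) ⊎ ∃ λ s → i ≤ s × s + h < m × Gap c s
    go fuel {i} m-i≤fuel i≤m ai with m ≤? i + h
    ... | yes near = inj₁ (hop c i≤m near am)
    ... | no  far with searchInterval (Alive c) (alive? c) i h
    ...   | inj₂ gap = inj₂ (i , ≤-refl , ≰⇒> far , gap)
    ...   | inj₁ (r , i<r , r≤i+h , ar) with fuel | m≤n⇒∃[o]m+o≡n (<⇒≤ i<r) | <⇒≤ (≤-<-trans r≤i+h (≰⇒> far))
    ...     | zero     | _      | r≤m = ⊥-elim (n≮0 (≤-trans (∸-monoʳ-< i<r r≤m) m-i≤fuel))
    ...     | suc fuel | e , refl | r≤m with go fuel (≤-pred (≤-trans (∸-monoʳ-< i<r r≤m) m-i≤fuel)) r≤m ar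
    ...       | inj₁ path = inj₁ (step (linked-node c i e (+-cancelˡ-≤ i 1 e (subst (_≤ i + e) (+-comm 1 i) i<r))
                                                     (+-cancelˡ-≤ i e h r≤i+h)) ar path)
    ...       | inj₂ (s , r≤s , s+h<m , gap) = inj₂ (s , ≤-trans (<⇒≤ i<r) r≤s , s+h<m , gap)

  segment-path-forward : ∀ c lo len → (∀ k → k < len → Alive c (lo + k)) →
    ∀ i j → i ≤ j → j < len → Path (node c (lo + i)) (node c (lo + j))
  segment-path-forward c lo len alive i j i≤j j<len
    with walk c (+-monoʳ-≤ lo i≤j) (alive i (≤-<-trans i≤j j<len)) (alive j j<len)
  ... | inj₁ path = path
  ... | inj₂ (s , lo+i≤s , s+h<lo+j , gap) = ⊥-elim (gap (suc s) ≤-refl 1+s≤s+h (subst (Alive c) (sym 1+s≡) (alive _ k<len)))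
    where
    1+s≤s+h = subst (_≤ s + h) (+-comm s 1) (+-monoʳ-≤ s 1≤h)
    1+s≡ : suc s ≡ lo + (suc s ∸ lo)
    1+s≡ = sym (m+[n∸m]≡n (m≤n⇒m≤1+n (≤-trans (m≤m+n lo i) lo+i≤s)))
    k<len : suc s ∸ lo < len
    k<len = +-cancelˡ-< lo _ _ (subst (_< lo + len) 1+s≡
              (≤-<-trans 1+s≤s+h (<-trans s+h<lo+j (+-monoʳ-< lo j<len))))

  segment-path : ∀ c lo len → (∀ k → k < len → Alive c (lo + k)) →
    ∀ i j → i < len → j < len → Path (node c (lo + i)) (node c (lo + j))
  segment-path c lo len alive i j i<len j<len with ≤-total i j
  ... | inj₁ i≤j = segment-path-forward c lo len alive i j i≤j j<len
  ... | inj₂ j≤i = reverseᵖ (alive j j<len) (segment-path-forward c lo len alive j i j≤i i<len)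

  removed : ℕ → ℕ → ℕ
  removed c r = 𝟙 (lookup S (node c r))

  ∣S∣≡segmentSum : ∀ c → c ≤ N → ∣ S ∣ ≡ segmentSum 0 N (removed c)
  ∣S∣≡segmentSum c c≤N = begin
    ∣ S ∣                                ≡⟨ ∣S∣≡∑ S ⟩
    ∑[ x < N ] 𝟙 (lookup S x)            ≡⟨ sum-permute {N} (λ x → 𝟙 (lookup S x)) π ⟩
    ∑[ i < N ] removed c (toℕ i)         ≡⟨ ∑≡segmentSum N 0 (removed c) ⟩
    segmentSum 0 N (removed c)           ∎
    where
    open ≡-Reasoning
    offset-node : ∀ i → i < N → offset c (node c i) ≡ i
    offset-node i i<N = begin
      (P (node c i) + (N ∸ c)) % N  ≡⟨ cong (λ x → (x + (N ∸ c)) % N) (P-node c i) ⟩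
      ((c + i) % N + (N ∸ c)) % N   ≡⟨ [m%n+k]%n≡[m+k]%n (c + i) (N ∸ c) N ⟩
      (c + i + (N ∸ c)) % N         ≡⟨ cong (_% N) (trans (cong (_+ (N ∸ c)) (+-comm c i))
                                         (trans (+-assoc i c _) (cong (i +_) (m+[n∸m]≡n c≤N)))) ⟩
      (i + N) % N                   ≡⟨ [m+n]%n≡m%n i N ⟩
      i % N                         ≡⟨ m<n⇒m%n≡m i<N ⟩
      i                             ∎
    π = permutation (λ i → node c (toℕ i)) (λ y → fromℕ< (offset<N c y))
          (λ y → trans (cong (node c) (toℕ-fromℕ< _)) (node-offset c y c≤N))
          (λ i → toℕ-injective (trans (toℕ-fromℕ< _) (offset-node (toℕ i) (toℕ<n i))))

  removed≡0⇒alive : ∀ c r → removed c r ≡ 0 → Alive c r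
  removed≡0⇒alive c r eq r∈S with lookup S (node c r) | []=⇒lookup r∈S
  removed≡0⇒alive c r () r∈S | true | refl

  dead⇒removed≡1 : ∀ c r → ¬ Alive c r → removed c r ≡ 1
  dead⇒removed≡1 c r dead with lookup S (node c r) in eq
  ... | true  = refl
  ... | false = ⊥-elim (dead λ r∈S → true≢false (trans (sym ([]=⇒lookup r∈S)) eq))
    where
    true≢false : true ≢ false
    true≢false ()

  -- Relative to position c: an arc of α alive nodes, a gap of h, an arc of β alive nodes, a gap of h.
  TwoArcs : ℕ → ℕ → ℕ → Set
  TwoArcs c α β = N ≡ α + (h + (β + h)) × (∀ k → k < α → Alive c k) × (∀ k → k < β → Alive c (α + h + k))

  cross : ∀ c α β → c ≤ N → TwoArcs c α β → α + N % 2 ≤ β →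
    ∀ i j → i < α → j < β → Path (node c i) (node c (α + h + j))
  cross c α β c≤N (N≡ , first , second) shorter i j i<α j<β =
    segment-path c 0 α first i 0 i<α (≤-<-trans z≤n i<α)
      ++ᵖ step link (second k k<β) (segment-path c (α + h) β second k j k<β j<β)
    where
    y = proj₁ (diameter (node c 0))
    e = offset c y
    y≡ : node c e ≡ y
    y≡ = node-offset c y c≤N
    e≤N = <⇒≤ (offset<N c y)
    e-antipodal : arcDist N e ≡ N / 2
    e-antipodal = trans (sym (cycDist-node c 0 e e≤N))
                        (trans (cong (cycDist pos (node c 0)) y≡) (proj₁ (proj₂ (diameter (node c 0)))))
    landing = antipode-in-longer-arc N α β h e N≡ shorter 2h+3≤N e≤N e-antipodal
    k = proj₁ landing
    k<β = proj₂ (proj₂ landing)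
    link : Linked G (node c 0) (node c (α + h + k))
    link = subst (Linked G (node c 0)) (trans (sym y≡) (cong (node c) (proj₁ (proj₂ landing))))
                 (proj₂ (proj₂ (diameter (node c 0))))

  node-around : ∀ c α β k → N ≡ α + (h + (β + h)) → node ((c + (α + h)) % N) (β + h + k) ≡ node c k
  node-around c α β k N≡ = begin
    node ((c + (α + h)) % N) (β + h + k)  ≡⟨ node-rebase c (α + h) (β + h + k) ⟩
    node c (α + h + (β + h + k))          ≡⟨ cong (node c) (trans (rearrange α β h k) (cong (_+ k) (sym N≡))) ⟩
    node c (N + k)                        ≡⟨ node-wrap c k ⟩
    node c k                              ∎
    where
    open ≡-Reasoning
    rearrange : ∀ α β h k → α + h + (β + h + k) ≡ α + (h + (β + h)) + k
    rearrange = solve-∀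

  twoArcs-swap : ∀ c α β → TwoArcs c α β → TwoArcs ((c + (α + h)) % N) β α
  twoArcs-swap c α β (N≡ , first , second) = N≡′ , second′ , first′
    where
    N≡′ : N ≡ β + (h + (α + h))
    N≡′ = trans N≡ (rearrange α β h)
      where
      rearrange : ∀ α β h → α + (h + (β + h)) ≡ β + (h + (α + h))
      rearrange = solve-∀
    second′ : ∀ k → k < β → Alive ((c + (α + h)) % N) k
    second′ k k<β = subst (_∉ S) (sym (node-rebase c (α + h) k)) (second k k<β)
    first′ : ∀ k → k < α → Alive ((c + (α + h)) % N) (β + h + k)
    first′ k k<α = subst (_∉ S) (sym (node-around c α β k N≡)) (first k k<α)

  twoArcs-path : ∀ c α β → c ≤ N → TwoArcs c α β →
    ∀ i j → i < α → j < β → Path (node c i) (node c (α + h + j))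
  twoArcs-path c α β c≤N arcs@(N≡ , _ , second) i j i<α j<β with shorter-arc N α β h N≡
  ... | inj₁ α-shorter = cross c α β c≤N arcs α-shorter i j i<α j<β
  ... | inj₂ β-shorter = reverseᵖ (second j j<β)
        (subst₂ Path (node-rebase c (α + h) j) (node-around c α β i N≡)
          (cross ((c + (α + h)) % N) β α (m%n≤n _ N) (twoArcs-swap c α β arcs) β-shorter j i j<β i<α))

  -- Two full gaps of h nodes already account for all 2h deleted nodes.
  two-gaps⇒alive : ∀ c → c ≤ N → ∣ S ∣ ≡ h + h → ∀ s b a →
    N ≡ suc s + (h + (suc b + (h + a))) → Gap c s → Gap c (suc s + h + b) →
    (∀ k → k < suc s → Alive c k) ×
    (∀ k → k < suc b → Alive c (suc s + h + k)) ×
    (∀ k → k < a → Alive c (suc s + h + suc b + h + k))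
  two-gaps⇒alive c c≤N ∣S∣≡2h s b a N≡ gap₁ gap₂ =
      alive-on 0 (suc s) (m+n≡0⇒m≡0 x₁ rest≡0)
    , alive-on (suc s + h) (suc b) (m+n≡0⇒m≡0 x₂ (m+n≡0⇒n≡0 x₁ rest≡0))
    , alive-on (suc s + h + suc b + h) a (m+n≡0⇒n≡0 x₂ (m+n≡0⇒n≡0 x₁ rest≡0))
    where
    g = removed c
    alive-on : ∀ a l → segmentSum a l g ≡ 0 → ∀ k → k < l → Alive c (a + k)
    alive-on a l none k k<l = removed≡0⇒alive c _ (segmentSum≡0 a l g none k k<l)
    full : ∀ s → Gap c s → segmentSum (suc s) h g ≡ h
    full s gap = segmentSum-ones (suc s) h g λ k k<h →
      dead⇒removed≡1 c _ (gap (suc s + k) (s≤s (m≤m+n s k)) (subst (_≤ s + h) (+-suc s k) (+-monoʳ-≤ s k<h)))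
    x₁ = segmentSum 0 (suc s) g
    x₂ = segmentSum (suc s + h) (suc b) g
    x₃ = segmentSum (suc s + h + suc b + h) a g
    total : x₁ + (h + (x₂ + (h + x₃))) ≡ h + h
    total = begin
      x₁ + (h + (x₂ + (h + x₃)))
        ≡⟨ cong₂ (λ y z → x₁ + (y + (x₂ + (z + x₃)))) (sym (full s gap₁))
                 (trans (sym (full _ gap₂)) (cong (λ p → segmentSum p h g) (sym (+-suc (suc s + h) b)))) ⟩
      x₁ + (segmentSum (suc s) h g + (x₂ + (segmentSum (suc s + h + suc b) h g + x₃)))
        ≡⟨ sym (segmentSum-++₅ 0 (suc s) h (suc b) h a g) ⟩
      segmentSum 0 (suc s + (h + (suc b + (h + a)))) g
        ≡⟨ trans (cong (λ l → segmentSum 0 l g) (sym N≡)) (sym (∣S∣≡segmentSum c c≤N)) ⟩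
      ∣ S ∣
        ≡⟨ ∣S∣≡2h ⟩
      h + h ∎
      where open ≡-Reasoning
    rest≡0 : x₁ + (x₂ + x₃) ≡ 0
    rest≡0 = +-cancelʳ-≡ (h + h) _ 0 (trans (rearrange x₁ x₂ x₃ h) total)
      where
      rearrange : ∀ x₁ x₂ x₃ h → x₁ + (x₂ + x₃) + (h + h) ≡ x₁ + (h + (x₂ + (h + x₃)))
      rearrange = solve-∀

  node-rotate : ∀ c s b a y → N ≡ suc s + (h + (suc b + (h + a))) →
    node ((c + (suc s + h + suc b + h)) % N) (a + y) ≡ node c y
  node-rotate c s b a y N≡ = begin
    node ((c + X) % N) (a + y) ≡⟨ node-rebase c X (a + y) ⟩
    node c (X + (a + y))       ≡⟨ cong (node c) (trans (rearrange s h b a y) (cong (_+ y) (sym N≡))) ⟩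
    node c (N + y)             ≡⟨ node-wrap c y ⟩
    node c y                   ∎
    where
    open ≡-Reasoning
    X = suc s + h + suc b + h
    rearrange : ∀ s h b a y → suc s + h + suc b + h + (a + y) ≡ suc s + (h + (suc b + (h + a))) + y
    rearrange = solve-∀

  -- Moving the origin to the start of the last segment joins the last and the first segment.
  two-gaps⇒twoArcs : ∀ c → c ≤ N → ∣ S ∣ ≡ h + h → ∀ s b a → N ≡ suc s + (h + (suc b + (h + a))) →
    Gap c s → Gap c (suc s + h + b) → TwoArcs ((c + (suc s + h + suc b + h)) % N) (a + suc s) (suc b)
  two-gaps⇒twoArcs c c≤N ∣S∣≡2h s b a N≡ gap₁ gap₂ = trans N≡ (rearrange s h b a) , first , second
    where
    alive = two-gaps⇒alive c c≤N ∣S∣≡2h s b a N≡ gap₁ gap₂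
    X = suc s + h + suc b + h
    rearrange : ∀ s h b a → suc s + (h + (suc b + (h + a))) ≡ a + suc s + (h + (suc b + h))
    rearrange = solve-∀
    first : ∀ k → k < a + suc s → Alive ((c + X) % N) k
    first k k<α with k <? a
    ... | yes k<a = subst (_∉ S) (sym (node-rebase c X k)) (proj₂ (proj₂ alive) k k<a)
    ... | no  k≮a with m≤n⇒∃[o]m+o≡n (≮⇒≥ k≮a)
    ...   | k′ , refl = subst (_∉ S) (sym (node-rotate c s b a k′ N≡)) (proj₁ alive k′ (+-cancelˡ-< a k′ (suc s) k<α))
    second : ∀ k → k < suc b → Alive ((c + X) % N) (a + suc s + h + k)
    second k k<b = subst (_∉ S) (sym (trans (cong (node ((c + X) % N)) (trans (+-assoc (a + suc s) h k) (+-assoc a (suc s) (h + k))))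
                                            (node-rotate c s b a (suc s + (h + k)) N≡)))
                          (subst (Alive c) (+-assoc (suc s) h k) (proj₁ (proj₂ alive) k k<b))

  connected-when-stuck : ∣ S ∣ ≡ h + h → ∀ u v → u ∉ S → v ∉ S → ∀ s t →
    s + h < offset (P u) v → offset (P u) v ≤ t → t + h < N → Gap (P u) s → Gap (P u) t → Path u v
  connected-when-stuck ∣S∣≡2h u v u∉S v∉S s t s+h<m m≤t t+h<N gap₁ gap₂ =
    subst₂ Path u≡ v≡ (twoArcs-path c′ (a + suc s) (suc b) (m%n≤n _ N)
                         (two-gaps⇒twoArcs c c≤N ∣S∣≡2h s b a N≡ gap₁ (subst (Gap c) t≡ gap₂))
                         a j₀ (m<m+n a (s≤s z≤n)) (s≤s (m≤m+n j₀ x)))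
    where
    c = P u
    c≤N = <⇒≤ (toℕ<n (pos u))
    j₀ = proj₁ (m≤n⇒∃[o]m+o≡n s+h<m)
    x  = proj₁ (m≤n⇒∃[o]m+o≡n m≤t)
    a  = proj₁ (m≤n⇒∃[o]m+o≡n t+h<N)
    b  = j₀ + x
    c′ = (c + (suc s + h + suc b + h)) % N
    m≡ : offset c v ≡ suc s + h + j₀
    m≡ = sym (proj₂ (m≤n⇒∃[o]m+o≡n s+h<m))
    t≡ : t ≡ suc s + h + b
    t≡ = trans (sym (proj₂ (m≤n⇒∃[o]m+o≡n m≤t))) (trans (cong (_+ x) m≡) (+-assoc (suc s + h) j₀ x))
    N≡ : N ≡ suc s + (h + (suc b + (h + a)))
    N≡ = trans (sym (proj₂ (m≤n⇒∃[o]m+o≡n t+h<N))) (trans (cong (λ z → suc (z + h) + a) t≡) (rearrange s h b a))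
      where
      rearrange : ∀ s h b a → suc (suc s + h + b + h) + a ≡ suc s + (h + (suc b + (h + a)))
      rearrange = solve-∀
    u≡ : node c′ a ≡ u
    u≡ = trans (cong (node c′) (sym (+-identityʳ a))) (trans (node-rotate c s b a 0 N≡) (node-P u))
    v≡ : node c′ (a + suc s + h + j₀) ≡ v
    v≡ = trans (cong (node c′) (trans (+-assoc (a + suc s) h j₀) (+-assoc a (suc s) (h + j₀))))
         (trans (node-rotate c s b a (suc s + (h + j₀)) N≡)
         (trans (cong (node c) (trans (sym (+-assoc (suc s) h j₀)) (sym m≡))) (node-offset c v c≤N)))

  connected : ∣ S ∣ ≡ h + h → ConnectedWithout G S
  connected ∣S∣≡2h u v u∉S v∉S = from-walks (walk c z≤n alive-u alive-v) (walk c m≤N alive-v alive-u′)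
    where
    c = P u
    m = offset c v
    m≤N = <⇒≤ (offset<N c v)
    v≡ : node c m ≡ v
    v≡ = node-offset c v (<⇒≤ (toℕ<n (pos u)))
    u′≡ : node c N ≡ u
    u′≡ = trans (cong (node c) (sym (+-identityʳ N))) (trans (node-wrap c 0) (node-P u))
    alive-u : Alive c 0
    alive-u = subst (_∉ S) (sym (node-P u)) u∉S
    alive-v : Alive c m
    alive-v = subst (_∉ S) (sym v≡) v∉S
    alive-u′ : Alive c N
    alive-u′ = subst (_∉ S) (sym u′≡) u∉S
    from-walks : Path (node c 0) (node c m) ⊎ ∃ (λ s → 0 ≤ s × s + h < m × Gap c s) →
                 Path (node c m) (node c N) ⊎ ∃ (λ t → m ≤ t × t + h < N × Gap c t) → Path u v
    from-walks (inj₁ path) _ = subst₂ Path (node-P u) v≡ path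
    from-walks (inj₂ _) (inj₁ path) = reverseᵖ v∉S (subst₂ Path v≡ u′≡ path)
    from-walks (inj₂ (s , _ , s+h<m , gap₁)) (inj₂ (t , m≤t , t+h<N , gap₂)) =
      connected-when-stuck ∣S∣≡2h u v u∉S v∉S s t s+h<m m≤t t+h<N gap₁ gap₂

robust : ∀ {N} h → h + h + 3 ≤ N → 1 ≤ h → (G : Graph N) (pos : CyclePos N) → Injective _≡_ _≡_ pos →
  (∀ u v → u ≢ v → cycDist pos u v ≤ h → Linked G u v) →
  (∀ u → ∃ λ v → cycDist pos u v ≡ N / 2 × Linked G u v) →
  Robust (h + h) G
robust {N} h 2h+3≤N 1≤h G pos pos-inj short diameter S ∣S∣≡2h =
  Robustness.connected h 2h+3≤N 1≤h G pos inv pos∘inv inv∘pos short diameter S ∣S∣≡2h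
  where
  instance
    N≢0 : NonZero N
    N≢0 = >-nonZero (≤-trans (s≤s z≤n) (≤-trans (m≤n+m 3 (h + h)) 2h+3≤N))
  inv : CyclePos N
  inv y = proj₁ (surjective pos pos-inj y)
  pos∘inv : ∀ y → pos (inv y) ≡ y
  pos∘inv y = proj₂ (surjective pos pos-inj y)
  inv∘pos : ∀ x → inv (pos x) ≡ x
  inv∘pos x = pos-inj (pos∘inv (pos x))

data NewOrOld {n} : Fin (suc n) → Set where
  new : NewOrOld (fromℕ n)
  old : (u : Fin n) → NewOrOld (inject₁ u)

newOrOld : ∀ {n} (x : Fin (suc n)) → NewOrOld x
newOrOld {zero}  zero    = new
newOrOld {suc n} zero    = old zero
newOrOld {suc n} (suc x) with newOrOld x
... | new   = new
... | old u = old (suc u)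

module Growth (Nf : ℕ) {n} {pos : CyclePos n} {G : Graph n} {pos′ : CyclePos (suc n)} {G′ : Graph (suc n)}
  (grow : GrowthStep Nf pos G pos′ G′) where

  h : ℕ
  h = Nf / 2

  private
    w = fromℕ n
    p = proj₁ (proj₁ grow)
    pos′-new : toℕ (pos′ w) ≡ p
    pos′-new = proj₁ (proj₂ (proj₂ (proj₁ grow)))
    pos′-old : ∀ u → toℕ (pos′ (inject₁ u)) ≡ shiftAt p (toℕ (pos u))
    pos′-old = proj₂ (proj₂ (proj₂ (proj₁ grow)))
    even-step = proj₁ (proj₂ grow)
    odd-step = proj₂ (proj₂ grow)

  links-preserved : ∀ u v → Linked G u v → Linked G′ (inject₁ u) (inject₁ v)
  links-preserved u v l with n%2≡0⊎n%2≡1 (suc n)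
  ... | inj₁ even = from (proj₁ (even-step even) u v) (inj₁ l)
  ... | inj₂ odd  = from (proj₁ (odd-step odd) u v) l

  pos′-injective : Injective _≡_ _≡_ pos → Injective _≡_ _≡_ pos′
  pos′-injective pos-inj {x} {y} eq with newOrOld x | newOrOld y
  ... | new   | new   = refl
  ... | old u | old v = cong inject₁ (pos-inj (toℕ-injective
                          (shiftAt-injective p (trans (sym (pos′-old u)) (trans (cong toℕ eq) (pos′-old v))))))
  ... | old u | new   = ⊥-elim (shiftAt≢ p _ (trans (sym (pos′-old u)) (trans (cong toℕ eq) pos′-new)))
  ... | new   | old v = ⊥-elim (shiftAt≢ p _ (trans (sym (pos′-old v)) (trans (cong toℕ (sym eq)) pos′-new)))

  private
    cycDist-old : ∀ u v →
      cycDist pos′ (inject₁ u) (inject₁ v) ≡ arcDist (suc n) ∣ shiftAt p (toℕ (pos u)) - shiftAt p (toℕ (pos v)) ∣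
    cycDist-old u v = cong₂ (λ a b → arcDist (suc n) ∣ a - b ∣) (pos′-old u) (pos′-old v)

    ∣pos-pos∣≤n : ∀ u v → ∣ toℕ (pos u) - toℕ (pos v) ∣ ≤ n
    ∣pos-pos∣≤n u v = <⇒≤ (∣m-n∣<o (toℕ<n (pos u)) (toℕ<n (pos v)))

  cycDist-old-≤ : ∀ u v → cycDist pos u v ≤ cycDist pos′ (inject₁ u) (inject₁ v)
  cycDist-old-≤ u v = subst (cycDist pos u v ≤_) (sym (cycDist-old u v))
    (arcDist-insert-≤ n _ _ (∣pos-pos∣≤n u v) (shiftAt-∣-∣ p _ _))

  cycDist-old-antipodal : ∀ m u v → m + m ≡ n → cycDist pos u v ≡ m → cycDist pos′ (inject₁ u) (inject₁ v) ≡ m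
  cycDist-old-antipodal m u v refl eq =
    trans (cycDist-old u v) (arcDist-insert-antipodal m _ _ (∣pos-pos∣≤n u v) eq (shiftAt-∣-∣ p _ _))

  private
    linked-new : ∀ y → y ≢ w → cycDist pos′ w y ≤ h → Linked G′ w y
    linked-new y y≢w d≤h with n%2≡0⊎n%2≡1 (suc n)
    ... | inj₁ even = from (proj₂ (even-step even) y) (inj₁ (y≢w , d≤h))
    ... | inj₂ odd  = from (proj₂ (proj₂ (proj₂ (odd-step odd))) y) (inj₁ (y≢w , d≤h))

  short-links : (∀ u v → u ≢ v → cycDist pos u v ≤ h → Linked G u v) →
                (∀ x y → x ≢ y → cycDist pos′ x y ≤ h → Linked G′ x y)
  short-links short x y x≢y d≤h with newOrOld x | newOrOld y
  ... | new   | new   = ⊥-elim (x≢y refl)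
  ... | new   | old v = linked-new (inject₁ v) (fromℕ≢inject₁ ∘ sym) d≤h
  ... | old u | new   = linked-sym G′
        (linked-new (inject₁ u) (fromℕ≢inject₁ ∘ sym) (subst (_≤ h) (cycDist-sym pos′ (inject₁ u) w) d≤h))
  ... | old u | old v = links-preserved u v (short u v (x≢y ∘ cong inject₁) (≤-trans (cycDist-old-≤ u v) d≤h))

  diameter-links-even : suc n % 2 ≡ 0 → ∀ x y → cycDist pos′ x y ≡ suc n / 2 → Linked G′ x y
  diameter-links-even even x y d≡ with newOrOld x | newOrOld y
  ... | new   | _     = from (proj₂ (even-step even) y) (inj₂ d≡)
  ... | old u | new   = linked-sym G′
        (from (proj₂ (even-step even) (inject₁ u)) (inj₂ (trans (cycDist-sym pos′ w (inject₁ u)) d≡)))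
  ... | old u | old v = from (proj₁ (even-step even) u v) (inj₂ d≡)

  diameter-links-odd : suc n % 2 ≡ 1 →
    (∀ u → ∃ λ v → cycDist pos u v ≡ n / 2 × Linked G u v) →
    (∀ x → ∃ λ y → cycDist pos′ x y ≡ suc n / 2 × Linked G′ x y)
  diameter-links-odd odd diameter x with newOrOld x
  ... | new = t , trans (proj₁ (proj₂ chosen)) (odd⇒[n∸1]/2≡n/2 (suc n) odd) , from (proj₂ (proj₂ chosen) t) (inj₂ refl)
    where
    chosen = proj₂ (odd-step odd)
    t = proj₁ chosen
  ... | old u = inject₁ v , trans (cycDist-old-antipodal (n / 2) u v n/2+n/2≡n (proj₁ (proj₂ (diameter u)))) n/2≡
              , links-preserved u v (proj₂ (proj₂ (diameter u)))
    where
    v = proj₁ (diameter u)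
    even = 1+n-odd⇒even n odd
    n/2+n/2≡n = even⇒n/2+n/2≡n n even
    n/2≡ : n / 2 ≡ suc n / 2
    n/2≡ = sym (trans (cong (λ k → suc k / 2) (sym n/2+n/2≡n)) ([1+m+m]/2≡m (n / 2)))

  module _ (pos′-inj : Injective _≡_ _≡_ pos′) where
    open CycleCounting pos′ pos′-inj

    private
      numLinks′≡ : numLinks G′ ≡
        countPairs n (λ u v → adj G′ (inject₁ u) (inject₁ v)) + ∑[ u < n ] 𝟙 (adj G′ w (inject₁ u))
      numLinks′≡ = trans (numLinks≡countPairs G′) (trans (countPairs-last n (adj G′))
        (cong (countPairs n (λ u v → adj G′ (inject₁ u) (inject₁ v)) +_)
              (sum-cong-≗ {n} λ u → cong 𝟙 (adj-sym G′ (inject₁ u) w))))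

    links-step-odd : suc n % 2 ≡ 1 → numLinks G′ ≤ numLinks G + (h * 2 + 1)
    links-step-odd odd = begin
      numLinks G′
        ≡⟨ numLinks′≡ ⟩
      countPairs n (λ u v → adj G′ (inject₁ u) (inject₁ v)) + ∑[ u < n ] 𝟙 (adj G′ w (inject₁ u))
        ≤⟨ +-mono-≤ (countPairs-mono n (λ u v → to (proj₁ (odd-step odd) u v))) (∑-init-≤ (λ y → 𝟙 (adj G′ w y))) ⟩
      countPairs n (adj G) + ∑[ y < suc n ] 𝟙 (adj G′ w y)
        ≤⟨ +-mono-≤ (≤-reflexive (sym (numLinks≡countPairs G))) new-degree ⟩
      numLinks G + (h * 2 + 1) ∎
      where
      open ≤-Reasoning
      chosen = proj₂ (odd-step odd)
      t = proj₁ chosen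
      new-degree : ∑[ y < suc n ] 𝟙 (adj G′ w y) ≤ h * 2 + 1
      new-degree = begin
        ∑[ y < suc n ] 𝟙 (adj G′ w y)
          ≤⟨ ∑-mono-≤ {suc n} (λ y → 𝟙-≤-+ λ l →
               Sum.map (λ (y≢w , d≤h) → near-pos h w y (y≢w ∘ sym) d≤h) (𝟙-true ∘ ≡ᵇ-true ∘ cong toℕ)
                            (to (proj₂ (proj₂ chosen) y) l)) ⟩
        ∑[ y < suc n ] (near h w y + 𝟙 (toℕ y ≡ᵇ toℕ t))
          ≡⟨ ∑-distrib-+ (near h w) (λ y → 𝟙 (toℕ y ≡ᵇ toℕ t)) ⟩
        ∑[ y < suc n ] near h w y + ∑[ y < suc n ] 𝟙 (toℕ y ≡ᵇ toℕ t)
          ≤⟨ +-mono-≤ (∑-near-≤ h w) (∑-𝟙-unique-≤1 {suc n} (λ y → toℕ y ≡ᵇ toℕ t)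
               λ i j i≡t j≡t → toℕ-injective (trans (≡ᵇ-sound i≡t) (sym (≡ᵇ-sound j≡t)))) ⟩
        h * 2 + 1 ∎

    links-step-even : suc n % 2 ≡ 0 → numLinks G′ ≤ numLinks G + (suc n / 2 + h * 2)
    links-step-even even = begin
      numLinks G′
        ≡⟨ numLinks′≡ ⟩
      countPairs n (λ u v → adj G′ (inject₁ u) (inject₁ v)) + ∑[ u < n ] 𝟙 (adj G′ w (inject₁ u))
        ≤⟨ +-mono-≤ (countPairs-∪ n old-link) new-links ⟩
      (countPairs n (adj G) + countPairs n (λ u v → A (inject₁ u) (inject₁ v)))
        + (∑[ u < n ] near h w (inject₁ u) + ∑[ u < n ] 𝟙 (A (inject₁ u) w))
        ≡⟨ rearrange (countPairs n (adj G)) (countPairs n (λ u v → A (inject₁ u) (inject₁ v)))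
                     (∑[ u < n ] near h w (inject₁ u)) (∑[ u < n ] 𝟙 (A (inject₁ u) w)) ⟩
      countPairs n (adj G)
        + ((countPairs n (λ u v → A (inject₁ u) (inject₁ v)) + ∑[ u < n ] 𝟙 (A (inject₁ u) w))
           + ∑[ u < n ] near h w (inject₁ u))
        ≡⟨ cong₂ (λ x y → x + (y + ∑[ u < n ] near h w (inject₁ u)))
                 (sym (numLinks≡countPairs G)) (sym (countPairs-last n A)) ⟩
      numLinks G + (countPairs (suc n) A + ∑[ u < n ] near h w (inject₁ u))
        ≤⟨ +-monoʳ-≤ (numLinks G) (+-mono-≤ (antipodal-pairs-≤ even) (≤-trans (∑-init-≤ (near h w)) (∑-near-≤ h w))) ⟩
      numLinks G + (H + h * 2) ∎
      where
      open ≤-Reasoning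
      H = suc n / 2
      A : Fin (suc n) → Fin (suc n) → Bool
      A x y = cycDist pos′ x y ≡ᵇ H
      rearrange : ∀ a b c d → (a + b) + (c + d) ≡ a + ((b + d) + c)
      rearrange = solve-∀
      old-link : ∀ u v → adj G′ (inject₁ u) (inject₁ v) ≡ true → adj G u v ≡ true ⊎ A (inject₁ u) (inject₁ v) ≡ true
      old-link u v l = Sum.map₂ ≡ᵇ-true (to (proj₁ (even-step even) u v) l)
      new-links : ∑[ u < n ] 𝟙 (adj G′ w (inject₁ u)) ≤
                  ∑[ u < n ] near h w (inject₁ u) + ∑[ u < n ] 𝟙 (A (inject₁ u) w)
      new-links = ≤-trans (∑-mono-≤ {n} λ u → 𝟙-≤-+ λ l →
          Sum.map (λ (u≢w , d≤h) → near-pos h w (inject₁ u) (u≢w ∘ sym) d≤h)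
                       (λ d≡H → 𝟙-true (≡ᵇ-true (trans (cycDist-sym pos′ (inject₁ u) w) d≡H)))
                       (to (proj₂ (even-step even) (inject₁ u)) l))
        (≤-reflexive (∑-distrib-+ (λ u → near h w (inject₁ u)) (λ u → 𝟙 (A (inject₁ u) w))))

linkBudget : ℕ → ℕ → ℕ
linkBudget h n = 8 * (n * (h + h + 1)) + n * n

budget-initial-even : ∀ n h L → L + L ≤ n * (h * 2 + 2) → 8 * L ≤ linkBudget h n
budget-initial-even n h L 2L≤ = begin
  8 * L                                    ≡⟨ e₁ L ⟩
  4 * (L + L)                              ≤⟨ *-monoʳ-≤ 4 2L≤ ⟩
  4 * (n * (h * 2 + 2))                    ≤⟨ m≤m+n _ _ ⟩
  4 * (n * (h * 2 + 2)) + (n * h * 8 + n * n) ≡⟨ e₂ n h ⟩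
  linkBudget h n                           ∎
  where
  open ≤-Reasoning
  e₁ : ∀ L → 8 * L ≡ 4 * (L + L)
  e₁ = solve-∀
  e₂ : ∀ n h → 4 * (n * (h * 2 + 2)) + (n * h * 8 + n * n) ≡ 8 * (n * (h + h + 1)) + n * n
  e₂ = solve-∀

budget-initial-odd : ∀ n h L → 2 ≤ n → L + L ≤ n * (h * 2 + 2) → 8 * L + n + n ≤ linkBudget h n + 1
budget-initial-odd .(2 + n′) h L (s≤s (s≤s {n = n′} _)) 2L≤ = begin
  8 * L + n + n                            ≡⟨ e₁ L n ⟩
  4 * (L + L) + n + n                      ≤⟨ +-monoˡ-≤ n (+-monoˡ-≤ n (*-monoʳ-≤ 4 2L≤)) ⟩
  4 * (n * (h * 2 + 2)) + n + n            ≤⟨ m≤m+n _ _ ⟩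
  4 * (n * (h * 2 + 2)) + n + n + (n * h * 8 + n * n′ + 1) ≡⟨ e₂ n′ h ⟩
  linkBudget h n + 1                       ∎
  where
  n = 2 + n′
  open ≤-Reasoning
  e₁ : ∀ L n → 8 * L + n + n ≡ 4 * (L + L) + n + n
  e₁ = solve-∀
  e₂ : ∀ n′ h → 4 * ((2 + n′) * (h * 2 + 2)) + (2 + n′) + (2 + n′) + ((2 + n′) * h * 8 + (2 + n′) * n′ + 1)
               ≡ 8 * ((2 + n′) * (h + h + 1)) + (2 + n′) * (2 + n′) + 1
  e₂ = solve-∀

budget-step-to-odd : ∀ n h L L′ → 8 * L ≤ linkBudget h n → L′ ≤ L + (h * 2 + 1) →
  8 * L′ + suc n + suc n ≤ linkBudget h (suc n) + 1
budget-step-to-odd n h L L′ 8L≤ L′≤ = begin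
  8 * L′ + suc n + suc n                              ≤⟨ +-monoˡ-≤ (suc n) (+-monoˡ-≤ (suc n) (*-monoʳ-≤ 8 L′≤)) ⟩
  8 * (L + (h * 2 + 1)) + suc n + suc n               ≡⟨ e₁ L h n ⟩
  8 * L + (8 * (h * 2 + 1) + suc n + suc n)           ≤⟨ +-monoˡ-≤ _ 8L≤ ⟩
  linkBudget h n + (8 * (h * 2 + 1) + suc n + suc n)  ≡⟨ e₂ h n ⟩
  linkBudget h (suc n) + 1                            ∎
  where
  open ≤-Reasoning
  e₁ : ∀ L h n → 8 * (L + (h * 2 + 1)) + suc n + suc n ≡ 8 * L + (8 * (h * 2 + 1) + suc n + suc n)
  e₁ = solve-∀
  e₂ : ∀ h n → 8 * (n * (h + h + 1)) + n * n + (8 * (h * 2 + 1) + suc n + suc n)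
             ≡ 8 * (suc n * (h + h + 1)) + suc n * suc n + 1
  e₂ = solve-∀

budget-step-to-even : ∀ n h L L′ H → H + H ≡ suc n → 8 * L + n + n ≤ linkBudget h n + 1 →
  L′ ≤ L + (H + h * 2) → 8 * L′ ≤ linkBudget h (suc n)
budget-step-to-even n h L L′ H H+H≡ 8L+2n≤ L′≤ = +-cancelʳ-≤ (n + n) _ _ (begin
  8 * L′ + (n + n)                                  ≤⟨ +-monoˡ-≤ (n + n) (*-monoʳ-≤ 8 L′≤) ⟩
  8 * (L + (H + h * 2)) + (n + n)                   ≡⟨ e₁ L H h n ⟩
  (8 * L + n + n) + (4 * (H + H) + h * 16)          ≤⟨ +-mono-≤ 8L+2n≤ (≤-reflexive (cong (λ x → 4 * x + h * 16) H+H≡)) ⟩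
  linkBudget h n + 1 + (4 * suc n + h * 16)         ≤⟨ m≤m+n _ 4 ⟩
  linkBudget h n + 1 + (4 * suc n + h * 16) + 4     ≡⟨ e₂ h n ⟩
  linkBudget h (suc n) + (n + n)                    ∎)
  where
  open ≤-Reasoning
  e₁ : ∀ L H h n → 8 * (L + (H + h * 2)) + (n + n) ≡ (8 * L + n + n) + (4 * (H + H) + h * 16)
  e₁ = solve-∀
  e₂ : ∀ h n → 8 * (n * (h + h + 1)) + n * n + 1 + (4 * suc n + h * 16) + 4
             ≡ 8 * (suc n * (h + h + 1)) + suc n * suc n + (n + n)
  e₂ = solve-∀

module Construction (Nf : ℕ) (Nf-even : Nf % 2 ≡ 0) (0<Nf : 0 < Nf)
  (N₁ : ℕ) (large : ∀ k → Nf < (k + N₁) ∸ 2)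
  (pos : (k : ℕ) → CyclePos (k + N₁)) (G : (k : ℕ) → Graph (k + N₁))
  (pos₀-inj : Injective _≡_ _≡_ (pos 0)) (initial : InitialNet Nf (pos 0) (G 0))
  (grow : ∀ k → GrowthStep Nf (pos k) (G k) (pos (suc k)) (G (suc k))) where

  h : ℕ
  h = Nf / 2

  h+h≡Nf : h + h ≡ Nf
  h+h≡Nf = even⇒n/2+n/2≡n Nf Nf-even

  1≤h : 1 ≤ h
  1≤h = n≢0⇒n>0 λ h≡0 → <-irrefl (trans (sym (cong (λ x → x + x) h≡0)) h+h≡Nf) 0<Nf

  2h+3≤N : ∀ k → h + h + 3 ≤ k + N₁
  2h+3≤N k = subst (λ x → x + 3 ≤ k + N₁) (sym h+h≡Nf) (Nf+3≤ (k + N₁) (large k))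
    where
    Nf+3≤ : ∀ N → Nf < N ∸ 2 → Nf + 3 ≤ N
    Nf+3≤ (suc (suc N)) Nf<N = subst (_≤ suc (suc N)) (+-comm 3 Nf) (s≤s (s≤s Nf<N))

  2≤N : ∀ k → 2 ≤ k + N₁
  2≤N k = ≤-trans (s≤s (s≤s z≤n)) (≤-trans (m≤n+m 3 (h + h)) (2h+3≤N k))

  module Step k = Growth Nf {pos = pos k} {G k} {pos (suc k)} {G (suc k)} (grow k)

  instance
    N≢0 : ∀ {k} → NonZero (k + N₁)
    N≢0 {k} = >-nonZero (≤-trans (s≤s z≤n) (2≤N k))

  pos-injective : ∀ k → Injective _≡_ _≡_ (pos k)
  pos-injective zero    = pos₀-inj
  pos-injective (suc k) = Step.pos′-injective k (pos-injective k)

  short-links : ∀ k u v → u ≢ v → cycDist (pos k) u v ≤ h → Linked (G k) u v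
  short-links zero u v u≢v d≤h with n%2≡0⊎n%2≡1 N₁
  ... | inj₁ even = from (proj₁ initial even u v) (inj₁ (u≢v , d≤h))
  ... | inj₂ odd  = proj₁ (proj₂ initial odd) u v u≢v d≤h
  short-links (suc k) = Step.short-links k (short-links k)

  diameter-links : ∀ k u → ∃ λ v → cycDist (pos k) u v ≡ (k + N₁) / 2 × Linked (G k) u v
  diameter-links zero u with n%2≡0⊎n%2≡1 N₁
  ... | inj₁ even = v , d≡ , from (proj₁ initial even u v) (inj₂ d≡)
    where
    v = proj₁ (antipode (pos 0) pos₀-inj u)
    d≡ = proj₂ (antipode (pos 0) pos₀-inj u)
  ... | inj₂ odd with proj₁ (proj₂ (proj₂ (proj₂ initial odd))) u
  ...   | v , d≡ , l = v , trans d≡ (odd⇒[n∸1]/2≡n/2 N₁ odd) , l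
  diameter-links (suc k) u with n%2≡0⊎n%2≡1 (suc k + N₁)
  ... | inj₁ even = v , d≡ , Step.diameter-links-even k even u v d≡
    where
    v = proj₁ (antipode (pos (suc k)) (pos-injective (suc k)) u)
    d≡ = proj₂ (antipode (pos (suc k)) (pos-injective (suc k)) u)
  ... | inj₂ odd = Step.diameter-links-odd k odd (diameter-links k) u

  robust-all : ∀ k → Robust Nf (G k)
  robust-all k = subst (λ f → Robust f (G k)) h+h≡Nf
    (robust h (2h+3≤N k) 1≤h (G k) (pos k) (pos-injective k) (short-links k) (diameter-links k))

  fresh : ∀ {i j} → i ≤ j → (w : Fin (i + N₁)) → toℕ (fromℕ (j + N₁)) ≢ toℕ w
  fresh i≤j w eq = <-irrefl (sym (trans (sym (toℕ-fromℕ _)) eq)) (≤-trans (toℕ<n w) (+-monoˡ-≤ N₁ i≤j))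

  links-persist : ∀ {i j} → i ≤′ j → ∀ {u v} → Linked (G i) u v →
    ∀ x y → toℕ x ≡ toℕ u → toℕ y ≡ toℕ v → Linked (G j) x y
  links-persist ≤′-refl l x y x≡u y≡v rewrite toℕ-injective x≡u | toℕ-injective y≡v = l
  links-persist {i} (≤′-step {j} i≤′j) {u} {v} l x y x≡u y≡v with newOrOld x | newOrOld y
  ... | old x′ | old y′ = Step.links-preserved j x′ y′
        (links-persist i≤′j l x′ y′ (trans (sym (toℕ-inject₁ x′)) x≡u) (trans (sym (toℕ-inject₁ y′)) y≡v))
  ... | new    | _      = ⊥-elim (fresh (≤′⇒≤ i≤′j) u x≡u)
  ... | old _  | new    = ⊥-elim (fresh (≤′⇒≤ i≤′j) v y≡v)

  subnetwork : ∀ i j (i≤j : i ≤ j) → Subnetwork (idx≤ N₁ i≤j) (G i) (G j)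
  subnetwork i j i≤j u v l = links-persist (≤⇒≤′ i≤j) l _ _ (toℕ-inject≤ u _) (toℕ-inject≤ v _)

  links-initial : ∀ u v → Linked (G 0) u v → (u ≢ v × cycDist (pos 0) u v ≤ h) ⊎ cycDist (pos 0) u v ≡ N₁ / 2
  links-initial u v l with n%2≡0⊎n%2≡1 N₁
  ... | inj₁ even = to (proj₁ initial even u v) l
  ... | inj₂ odd  = Sum.map₂ (λ d≡ → trans d≡ (odd⇒[n∸1]/2≡n/2 N₁ odd)) (proj₁ (proj₂ (proj₂ initial odd)) u v l)

  -- At odd sizes the bound holds with slack 2N - 1, which pays for the up to N/2 antipodal
  -- links added by the next (even) step.
  LinkInvariant : ℕ → Set
  LinkInvariant k =
    ((k + N₁) % 2 ≡ 0 → 8 * numLinks (G k) ≤ linkBudget h (k + N₁)) ×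
    ((k + N₁) % 2 ≡ 1 → 8 * numLinks (G k) + (k + N₁) + (k + N₁) ≤ linkBudget h (k + N₁) + 1)

  link-invariant : ∀ k → LinkInvariant k
  link-invariant zero = (λ _ → budget-initial-even N₁ h (numLinks (G 0)) initial-bound)
                      , (λ _ → budget-initial-odd N₁ h (numLinks (G 0)) (2≤N 0) initial-bound)
    where initial-bound = numLinks-bound (pos 0) pos₀-inj (G 0) h (N₁ / 2) links-initial
  link-invariant (suc k) =
      (λ even → budget-step-to-even n h (numLinks (G k)) (numLinks (G (suc k))) (suc n / 2) (even⇒n/2+n/2≡n (suc n) even)
                  (proj₂ (link-invariant k) (1+n-even⇒odd n even))
                  (Step.links-step-even k (pos-injective (suc k)) even))
    , (λ odd → budget-step-to-odd n h (numLinks (G k)) (numLinks (G (suc k))) (proj₁ (link-invariant k) (1+n-odd⇒even n odd))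
                 (Step.links-step-odd k (pos-injective (suc k)) odd))
    where n = k + N₁

  link-bound : ∀ k → 8 * numLinks (G k) ≤ 8 * ((k + N₁) * (Nf + 1)) + (k + N₁) * (k + N₁)
  link-bound k = subst (λ f → 8 * numLinks (G k) ≤ 8 * ((k + N₁) * (f + 1)) + (k + N₁) * (k + N₁)) h+h≡Nf within-budget
    where
    within-budget : 8 * numLinks (G k) ≤ linkBudget h (k + N₁)
    within-budget with n%2≡0⊎n%2≡1 (k + N₁)
    ... | inj₁ even = proj₁ (link-invariant k) even
    ... | inj₂ odd  = +-cancelʳ-≤ 1 _ _ (≤-trans (+-monoʳ-≤ (8 * numLinks (G k)) 1≤2N)
                        (≤-trans (≤-reflexive (sym (+-assoc (8 * numLinks (G k)) (k + N₁) (k + N₁))))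
                                 (proj₂ (link-invariant k) odd)))
      where 1≤2N = ≤-trans (≤-trans (s≤s z≤n) (2≤N k)) (m≤m+n (k + N₁) (k + N₁))

theorem6 : (Nf : ℕ) → Nf % 2 ≡ 0 → 0 < Nf →
    (N₁ : ℕ) → (∀ k → Nf < (k + N₁) ∸ 2) →
    (pos : (k : ℕ) → CyclePos (k + N₁)) →
    (G : (k : ℕ) → Graph (k + N₁)) →
    Injective _≡_ _≡_ (pos 0) →
    InitialNet Nf (pos 0) (G 0) →
    (∀ k → GrowthStep Nf (pos k) (G k) (pos (suc k)) (G (suc k))) →
    (∀ i j (i≤j : i ≤ j) → Subnetwork (idx≤ N₁ i≤j) (G i) (G j)) ×
    (∀ k → Robust Nf (G k)) ×
    (∀ k → 8 * numLinks (G k) ≤ 8 * ((k + N₁) * (Nf + 1)) + (k + N₁) * (k + N₁))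
theorem6 Nf Nf-even 0<Nf N₁ large pos G pos₀-inj initial grow = subnetwork , robust-all , link-bound
  where open Construction Nf Nf-even 0<Nf N₁ large pos G pos₀-inj initial grow
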